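{- Let $q$ be a prime power and let $A$ be an $a$-dimensional and $B$ a $b$-dimensional subspace of $\mathbb{F}_q^{a+b-c}$, where $c=\dim(A\cap B)$. Then the number of $d$-dimensional subspaces $D$ of $\mathbb{F}_q^{a+b-c}$ with $D\cap A=D\cap B=\{0\}$ equals $$\psi(a,b,c,d) := \prod_{j=0}^{d-1} \frac{q^{j+c}(q^{a-c-j}-1)(q^{b-c-j}-1)}{q^{d-j}-1}.$$ -}

module Defs where

open import Level using (0ℓ)
open import Data.Nat using (ℕ; zero; suc; _∸_; _≤_) renaming (_+_ to _+ℕ_; _*_ to _*ℕ_; _^_ to _^ℕ_)
open import Data.Nat.Primality using (Prime)
open import Data.Fin using (Fin) renaming (zero to fzero; suc to fsuc)
open import Data.Vec using (Vec; replicate; zipWith; map; lookup)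
open import Data.Bool using (Bool; true; false)
open import Data.List using (List; length)
open import Data.List.Membership.Propositional using (_∈_)
open import Data.List.Relation.Unary.Any using (Any)
open import Data.List.Relation.Unary.AllPairs using (AllPairs)
open import Data.Product using (Σ; ∃; _×_)
open import Relation.Binary.PropositionalEquality using (_≡_; _≢_)
open import Relation.Nullary using (¬_)
open import Algebra.Structures using (IsCommutativeRing)
open import Function.Bundles using (_↔_)

IsPrimePower : ℕ → Set
IsPrimePower q = Σ ℕ λ p → Σ ℕ λ k → Prime p × 1 ≤ k × q ≡ p ^ℕ k

record FiniteField (q : ℕ) : Set₁ where
  infixl 6 _+_
  infixl 7 _*_
  field
    Carrier : Set
    _+_ _*_ : Carrier → Carrier → Carrier
    -_ : Carrier → Carrier
    0# 1# : Carrier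
    isCommutativeRing : IsCommutativeRing _≡_ _+_ _*_ -_ 0# 1#
    0≢1 : 0# ≢ 1#
    inverse : ∀ x → x ≢ 0# → ∃ λ y → x * y ≡ 1#
    enumeration : Fin q ↔ Carrier

module LinearAlgebra {q : ℕ} (F : FiniteField q) where
  open FiniteField F

  V : ℕ → Set
  V n = Vec Carrier n

  0v : ∀ {n} → V n
  0v = replicate _ 0#

  _+v_ : ∀ {n} → V n → V n → V n
  _+v_ = zipWith _+_

  _·v_ : ∀ {n} → Carrier → V n → V n
  k ·v v = map (k *_) v

  lincomb : ∀ {n} d → (Fin d → Carrier) → (Fin d → V n) → V n
  lincomb zero    c v = 0v
  lincomb (suc d) c v = (c fzero ·v v fzero) +v lincomb d (λ i → c (fsuc i)) (λ i → v (fsuc i))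

  SubsetV : ℕ → Set
  SubsetV n = V n → Bool

  _∋_ : ∀ {n} → SubsetV n → V n → Set
  S ∋ x = S x ≡ true

  _≐_ : ∀ {n} → SubsetV n → SubsetV n → Set
  S ≐ T = ∀ x → S x ≡ T x

  record IsSubspace {n} (S : SubsetV n) : Set where
    field
      zero-mem : S ∋ 0v
      +-closed : ∀ x y → S ∋ x → S ∋ y → S ∋ (x +v y)
      ·-closed : ∀ k x → S ∋ x → S ∋ (k ·v x)

  LinearlyIndependent : ∀ {n} d → (Fin d → V n) → Set
  LinearlyIndependent d v = ∀ c → lincomb d c v ≡ 0v → ∀ i → c i ≡ 0#

  IsBasis : ∀ {n} d → SubsetV n → (Fin d → V n) → Set
  IsBasis d S v = (∀ i → S ∋ v i) × LinearlyIndependent d v × (∀ x → S ∋ x → ∃ λ c → x ≡ lincomb d c v)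

  SubspaceOfDim : ∀ {n} → ℕ → SubsetV n → Set
  SubspaceOfDim d S = IsSubspace S × ∃ λ v → IsBasis d S v

  _∩_ : ∀ {n} → SubsetV n → SubsetV n → SubsetV n
  (S ∩ T) x with S x
  ... | true  = T x
  ... | false = false

  TrivialIntersection : ∀ {n} → SubsetV n → SubsetV n → Set
  TrivialIntersection D A = ∀ x → D ∋ x → A ∋ x → x ≡ 0v

  -- "the number of subsets satisfying P is N": a duplicate-free (up to ≐) list of
  -- subsets satisfying P which contains (up to ≐) every subset satisfying P, of length N
  CountIs : ∀ {n} → (SubsetV n → Set) → ℕ → Set
  CountIs {n} P N = Σ (List (SubsetV n)) λ L →
      (∀ {D} → D ∈ L → P D)
    × (∀ D → P D → Any (λ E → D ≐ E) L)
    × AllPairs (λ D E → ¬ (D ≐ E)) L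
    × length L ≡ N

prod : ℕ → (ℕ → ℕ) → ℕ
prod zero    f = 1
prod (suc d) f = prod d f *ℕ f d

ψ-num : ℕ → ℕ → ℕ → ℕ → ℕ → ℕ
ψ-num q a b c d = prod d λ j → q ^ℕ (j +ℕ c) *ℕ ((q ^ℕ (a ∸ c ∸ j)) ∸ 1) *ℕ ((q ^ℕ (b ∸ c ∸ j)) ∸ 1)

ψ-den : ℕ → ℕ → ℕ
ψ-den q d = prod d λ j → (q ^ℕ (d ∸ j)) ∸ 1

module Submission where

-- Idea: count ordered bases instead of subspaces.  Build lists (v_d, …, v_1)
-- one vector at a time, where each new vector avoids both W + A and W + B
-- for the span W of the vectors chosen so far ("avoiding chains").  These
-- are exactly the ordered bases of the subspaces D we want.  Since
-- A + B = F^n, the sets W + A and W + B together span F^n, so the product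
-- formula |X||Y| = |X + Y||X ∩ Y| and inclusion–exclusion show that a chain
-- of length j has exactly  q^j · q^(j+c) (q^(a-c-j) - 1)(q^(b-c-j) - 1)
-- extensions.  On the other hand every solution D has exactly
-- Π_{i<d} (q^d - q^i) ordered bases, so dividing gives the count.

open import Defs

open import Level using (0ℓ)
open import Data.Nat using (ℕ; zero; suc; _+_; _*_; _^_; _∸_; _≤_; _<_; z≤n; s≤s; NonZero; >-nonZero; nonTrivial⇒n>1; nonTrivial⇒nonZero)
open import Data.Nat.Properties hiding (_≟_)
open import Data.Nat.Primality using (prime)
open import Data.Nat.Tactic.RingSolver using (solve-∀)
open import Data.Bool using (Bool; true; false; _∧_; not)
import Data.Bool as Bool
open import Data.Bool.Properties using (∧-conicalˡ; ∧-conicalʳ)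
open import Data.List using (List; []; _∷_; map; _++_; concatMap; length; filter; deduplicate)
open import Data.List.Membership.Propositional using (_∈_; find)
open import Data.List.Membership.Propositional.Properties using (∈-map∘filter⁻; ∈-map∘filter⁺; ∈-deduplicate⁻)
open import Data.List.Relation.Unary.Any using (Any; here; there; satisfied) renaming (map to anyMap; any? to anyᴸ?)
import Data.List.Relation.Unary.Any.Properties as Anyₚ
open import Data.List.Relation.Unary.All using (all?) renaming (lookup to allLookup; tabulate to allTabulate)
open import Data.List.Relation.Unary.AllPairs using (_∷_)
import Data.List.Relation.Unary.Unique.DecSetoid as UniqueDecSetoid
open import Data.List.Relation.Unary.Unique.DecSetoid.Properties using (deduplicate-!)
open import Data.Vec using (Vec; []; _∷_; replicate; lookup; tabulate)
import Data.Vec.Properties as Vecₚ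
open import Data.Vec.Relation.Unary.All using (All; []; _∷_) renaming (map to allMap)
open import Data.Vec.Relation.Unary.All.Properties using (lookup⁺; tabulate⁺)
open import Data.Fin using (Fin) renaming (zero to fzero; suc to fsuc)
import Data.Fin.Properties as Finₚ
open import Data.Product using (Σ; ∃; _×_; _,_; proj₁; proj₂)
open import Data.Sum using (_⊎_; inj₁; inj₂)
open import Data.Empty using (⊥-elim)
open import Function.Bundles using (_↔_; Inverse; mk⇔)
open import Relation.Nullary using (¬_; Dec; yes; no; does; _because_; ¬?; _×-dec_)
open import Relation.Nullary.Reflects using (Reflects; ofʸ; ofⁿ)
open import Relation.Nullary.Decidable using (does-⇔; dec-true; dec-false; map′)
open import Relation.Binary.Bundles using (DecSetoid)
open import Relation.Binary.Definitions using (DecidableEquality)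
open import Relation.Binary.PropositionalEquality
open import Algebra.Bundles using (CommutativeRing)
open import Algebra.Structures using (IsCommutativeRing)
import Algebra.Properties.Ring as RingProperties
import Algebra.Properties.AbelianGroup as AbelianGroupProperties
open import Algebra.Properties.CommutativeSemigroup +-commutativeSemigroup using (interchange)

-- Finite sums over lists.  Every cardinality in this file is such a sum
-- of 0/1 indicators, so counting arguments become sum manipulations.

∑ : {A : Set} → List A → (A → ℕ) → ℕ
∑ []       f = 0
∑ (x ∷ xs) f = f x + ∑ xs f

module _ {A : Set} where

  ∑-cong-∈ : (xs : List A) {f g : A → ℕ} → (∀ {x} → x ∈ xs → f x ≡ g x) → ∑ xs f ≡ ∑ xs g
  ∑-cong-∈ []       e = refl
  ∑-cong-∈ (x ∷ xs) e = cong₂ _+_ (e (here refl)) (∑-cong-∈ xs (λ m → e (there m)))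

  ∑-cong : (xs : List A) {f g : A → ℕ} → (∀ x → f x ≡ g x) → ∑ xs f ≡ ∑ xs g
  ∑-cong xs e = ∑-cong-∈ xs (λ {x} _ → e x)

  ∑-zero : (xs : List A) {f : A → ℕ} → (∀ x → f x ≡ 0) → ∑ xs f ≡ 0
  ∑-zero []       e = refl
  ∑-zero (x ∷ xs) e = cong₂ _+_ (e x) (∑-zero xs e)

  ∑-+ : (xs : List A) (f g : A → ℕ) → ∑ xs (λ x → f x + g x) ≡ ∑ xs f + ∑ xs g
  ∑-+ []       f g = refl
  ∑-+ (x ∷ xs) f g = trans (cong (f x + g x +_) (∑-+ xs f g)) (interchange (f x) (g x) _ _)

  ∑-*ˡ : (xs : List A) (k : ℕ) (f : A → ℕ) → ∑ xs (λ x → k * f x) ≡ k * ∑ xs f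
  ∑-*ˡ []       k f = sym (*-zeroʳ k)
  ∑-*ˡ (x ∷ xs) k f = trans (cong (k * f x +_) (∑-*ˡ xs k f)) (sym (*-distribˡ-+ k (f x) _))

  ∑-*ʳ : (xs : List A) (k : ℕ) (f : A → ℕ) → ∑ xs (λ x → f x * k) ≡ ∑ xs f * k
  ∑-*ʳ xs k f = trans (∑-cong xs (λ x → *-comm (f x) k)) (trans (∑-*ˡ xs k f) (*-comm k _))

  ∑-const : (xs : List A) (k : ℕ) → ∑ xs (λ _ → k) ≡ length xs * k
  ∑-const []       k = refl
  ∑-const (x ∷ xs) k = cong (k +_) (∑-const xs k)

  ∑-++ : (xs ys : List A) (f : A → ℕ) → ∑ (xs ++ ys) f ≡ ∑ xs f + ∑ ys f
  ∑-++ []       ys f = refl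
  ∑-++ (x ∷ xs) ys f = trans (cong (f x +_) (∑-++ xs ys f)) (sym (+-assoc (f x) _ _))

  ∑-mono : (xs : List A) {f g : A → ℕ} → (∀ x → f x ≤ g x) → ∑ xs f ≤ ∑ xs g
  ∑-mono []       le = z≤n
  ∑-mono (x ∷ xs) le = +-mono-≤ (le x) (∑-mono xs le)

  ∑-mono-tight : (xs : List A) {f g : A → ℕ} → (∀ x → f x ≤ g x) → ∑ xs f ≡ ∑ xs g →
                 ∀ {x} → x ∈ xs → f x ≡ g x
  ∑-mono-tight (y ∷ xs) {f} {g} le eq (here refl) =
    ≤-antisym (le y) (+-cancelʳ-≤ (∑ xs f) (g y) (f y)
      (subst (g y + ∑ xs f ≤_) (sym eq) (+-monoʳ-≤ (g y) (∑-mono xs le))))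
  ∑-mono-tight (y ∷ xs) {f} {g} le eq (there m) =
    ∑-mono-tight xs le (≤-antisym (∑-mono xs le) (+-cancelˡ-≤ (g y) (∑ xs g) (∑ xs f)
      (subst (_≤ g y + ∑ xs f) eq (+-monoˡ-≤ (∑ xs f) (le y))))) m

module _ {A B : Set} where

  ∑-map : (xs : List A) (g : A → B) (f : B → ℕ) → ∑ (map g xs) f ≡ ∑ xs (λ x → f (g x))
  ∑-map []       g f = refl
  ∑-map (x ∷ xs) g f = cong (f (g x) +_) (∑-map xs g f)

  ∑-concatMap : (xs : List A) (g : A → List B) (f : B → ℕ) →
                ∑ (concatMap g xs) f ≡ ∑ xs (λ x → ∑ (g x) f)
  ∑-concatMap []       g f = refl
  ∑-concatMap (x ∷ xs) g f = trans (∑-++ (g x) (concatMap g xs) f) (cong (∑ (g x) f +_) (∑-concatMap xs g f))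

  ∑-swap : (xs : List A) (ys : List B) (f : A → B → ℕ) →
           ∑ xs (λ x → ∑ ys (f x)) ≡ ∑ ys (λ y → ∑ xs (λ x → f x y))
  ∑-swap []       ys f = sym (∑-zero ys (λ _ → refl))
  ∑-swap (x ∷ xs) ys f = trans (cong (∑ ys (f x) +_) (∑-swap xs ys f)) (sym (∑-+ ys (f x) _))

⟦_⟧ : Bool → ℕ
⟦ true  ⟧ = 1
⟦ false ⟧ = 0

⌊_⌋ : {P : Set} → Dec P → ℕ
⌊ d ⌋ = ⟦ does d ⟧

⟦∧⟧ : ∀ b c → ⟦ b ∧ c ⟧ ≡ ⟦ b ⟧ * ⟦ c ⟧
⟦∧⟧ true  c = sym (+-identityʳ _)
⟦∧⟧ false c = refl

⟦⟧-false : ∀ {b} → ¬ (b ≡ true) → ⟦ b ⟧ ≡ 0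
⟦⟧-false {true}  ne = ⊥-elim (ne refl)
⟦⟧-false {false} ne = refl

⟦⟧≡1⇒true : ∀ {b} → ⟦ b ⟧ ≡ 1 → b ≡ true
⟦⟧≡1⇒true {true} _ = refl

⟦⟧-mono : ∀ {a b} → (a ≡ true → b ≡ true) → ⟦ a ⟧ ≤ ⟦ b ⟧
⟦⟧-mono {false} _ = z≤n
⟦⟧-mono {true}  f rewrite f refl = s≤s z≤n

⟦∧not⟧ : ∀ a b → (b ≡ true → a ≡ true) → ⟦ a ∧ not b ⟧ + ⟦ b ⟧ ≡ ⟦ a ⟧
⟦∧not⟧ true  true  _ = refl
⟦∧not⟧ true  false _ = refl
⟦∧not⟧ false true  f with f refl
... | ()
⟦∧not⟧ false false _ = refl

⟦not∧not⟧ : ∀ a b → ⟦ not a ∧ not b ⟧ + ⟦ a ⟧ + ⟦ b ⟧ ≡ 1 + ⟦ a ∧ b ⟧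
⟦not∧not⟧ true  true  = refl
⟦not∧not⟧ true  false = refl
⟦not∧not⟧ false true  = refl
⟦not∧not⟧ false false = refl

true-iff : ∀ {a b} → (a ≡ true → b ≡ true) → (b ≡ true → a ≡ true) → a ≡ b
true-iff {true}  {true}  f g = refl
true-iff {true}  {false} f g = sym (f refl)
true-iff {false} {true}  f g = g refl
true-iff {false} {false} f g = refl

true? : ∀ b → (b ≡ true) ⊎ ¬ (b ≡ true)
true? true  = inj₁ refl
true? false = inj₂ (λ ())

⌊⌋-cong : ∀ {P Q : Set} (d : Dec P) (e : Dec Q) → (P → Q) → (Q → P) → ⌊ d ⌋ ≡ ⌊ e ⌋
⌊⌋-cong d e f g = cong ⟦_⟧ (does-⇔ (mk⇔ f g) d e)

does-sound : ∀ {P : Set} (d : Dec P) → does d ≡ true → P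
does-sound (yes p) _ = p

-- An enumeration of A lists every element exactly once; "exactly once" is
-- phrased with Kronecker deltas, which makes it usable inside sums.
record Enumeration (A : Set) : Set where
  field
    _≟_   : DecidableEquality A
    elems : List A

  δ : A → A → ℕ
  δ x y = ⌊ x ≟ y ⌋

  field
    exact : ∀ x → ∑ elems (δ x) ≡ 1

  card : ℕ
  card = ∑ elems (λ _ → 1)

  δ-≢ : ∀ {x y} → x ≢ y → δ x y ≡ 0
  δ-≢ {x} {y} ne with x ≟ y
  ... | yes p = ⊥-elim (ne p)
  ... | no  _ = refl

  complete : ∀ x → x ∈ elems
  complete x = go elems (λ e → 1≢0 (trans (sym (exact x)) e))
    where
    1≢0 : 1 ≢ 0
    1≢0 ()
    go : ∀ xs → ∑ xs (δ x) ≢ 0 → x ∈ xs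
    go []       nz = ⊥-elim (nz refl)
    go (y ∷ xs) nz with x ≟ y
    ... | yes p = here p
    ... | no  _ = there (go xs nz)

  pick : ∀ x (h : A → ℕ) → ∑ elems (λ y → δ x y * h y) ≡ h x
  pick x h = begin
      ∑ elems (λ y → δ x y * h y) ≡⟨ ∑-cong elems δh≡hδ ⟩
      ∑ elems (λ y → h x * δ x y) ≡⟨ ∑-*ˡ elems (h x) (δ x) ⟩
      h x * ∑ elems (δ x)         ≡⟨ cong (h x *_) (exact x) ⟩
      h x * 1                     ≡⟨ *-identityʳ (h x) ⟩
      h x                         ∎
    where
    open ≡-Reasoning
    δh≡hδ : ∀ y → δ x y * h y ≡ h x * δ x y
    δh≡hδ y with x ≟ y
    ... | yes refl = *-comm 1 (h x)
    ... | no  _    = sym (*-zeroʳ (h x))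


open Enumeration using (elems; complete; card)

finList : (n : ℕ) → List (Fin n)
finList zero    = []
finList (suc n) = fzero ∷ map fsuc (finList n)

finEnum : (n : ℕ) → Enumeration (Fin n)
finEnum n = record { _≟_ = Finₚ._≟_ ; elems = finList n ; exact = exact n }
  where
  exact : ∀ n (x : Fin n) → ∑ (finList n) (λ y → ⌊ x Finₚ.≟ y ⌋) ≡ 1
  exact (suc n) fzero    = cong suc (trans (∑-map (finList n) fsuc _) (∑-zero (finList n) (λ _ → refl)))
  exact (suc n) (fsuc x) = trans (∑-map (finList n) fsuc _)
    (trans (∑-cong (finList n) (λ y → ⌊⌋-cong (fsuc x Finₚ.≟ fsuc y) (x Finₚ.≟ y) Finₚ.suc-injective (cong fsuc)))
           (exact n x))

finEnum-card : ∀ n → card (finEnum n) ≡ n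
finEnum-card zero    = refl
finEnum-card (suc n) = cong suc (trans (∑-map (finList n) fsuc _) (finEnum-card n))

bijEnum : ∀ {A : Set} {n : ℕ} → Fin n ↔ A → Enumeration A
bijEnum {A} {n} iso = record { _≟_ = _≟_ ; elems = map to (finList n) ; exact = exact }
  where
  open Inverse iso
  _≟_ : DecidableEquality A
  x ≟ y with from x Finₚ.≟ from y
  ... | yes p = yes (trans (sym (strictlyInverseˡ x)) (trans (cong to p) (strictlyInverseˡ y)))
  ... | no ¬p = no (λ e → ¬p (cong from e))
  exact : ∀ x → ∑ (map to (finList n)) (λ y → ⌊ x ≟ y ⌋) ≡ 1
  exact x = trans (∑-map (finList n) to _)
    (trans (∑-cong (finList n) (λ i → ⌊⌋-cong (x ≟ to i) (from x Finₚ.≟ i)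
                 (λ e → trans (cong from e) (strictlyInverseʳ i))
                 (λ e → trans (sym (strictlyInverseˡ x)) (cong to e))))
           (Enumeration.exact (finEnum n) (from x)))

bijEnum-card : ∀ {A : Set} {n : ℕ} (iso : Fin n ↔ A) → card (bijEnum iso) ≡ n
bijEnum-card {n = n} iso = trans (∑-map (finList n) _ _) (finEnum-card n)

vecList : ∀ {A : Set} → List A → (n : ℕ) → List (Vec A n)
vecList xs zero    = [] ∷ []
vecList xs (suc n) = concatMap (λ x → map (x ∷_) (vecList xs n)) xs

vecEnum : ∀ {A : Set} → Enumeration A → (n : ℕ) → Enumeration (Vec A n)
vecEnum {A} E n = record { _≟_ = Vecₚ.≡-dec _≟_ ; elems = vecList xs n ; exact = exact n }
  where
  open Enumeration E using (_≟_; δ) renaming (elems to xs)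
  δᵥ : ∀ {n} → Vec A n → Vec A n → ℕ
  δᵥ u w = ⌊ Vecₚ.≡-dec _≟_ u w ⌋
  δᵥ-∷ : ∀ {n} x y (u w : Vec A n) → δᵥ (x ∷ u) (y ∷ w) ≡ δ x y * δᵥ u w
  δᵥ-∷ x y u w with x ≟ y | Vecₚ.≡-dec _≟_ u w
  ... | yes _ | yes _ = refl
  ... | yes _ | no  _ = refl
  ... | no  _ | _     = refl
  exact : ∀ n (v : Vec A n) → ∑ (vecList xs n) (δᵥ v) ≡ 1
  exact zero    [] = refl
  exact (suc n) (x ∷ u) = begin
      ∑ (concatMap (λ y → map (y ∷_) (vecList xs n)) xs) (δᵥ (x ∷ u))
    ≡⟨ ∑-concatMap xs _ _ ⟩
      ∑ xs (λ y → ∑ (map (y ∷_) (vecList xs n)) (δᵥ (x ∷ u)))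
    ≡⟨ ∑-cong xs (λ y → ∑-map (vecList xs n) (y ∷_) _) ⟩
      ∑ xs (λ y → ∑ (vecList xs n) (λ w → δᵥ (x ∷ u) (y ∷ w)))
    ≡⟨ ∑-cong xs (λ y → trans (∑-cong (vecList xs n) (δᵥ-∷ x y u)) (∑-*ˡ (vecList xs n) (δ x y) (δᵥ u))) ⟩
      ∑ xs (λ y → δ x y * ∑ (vecList xs n) (δᵥ u))
    ≡⟨ ∑-cong xs (λ y → trans (cong (δ x y *_) (exact n u)) (*-identityʳ _)) ⟩
      ∑ xs (δ x)
    ≡⟨ Enumeration.exact E x ⟩
      1 ∎
    where open ≡-Reasoning

vecEnum-card : ∀ {A : Set} (E : Enumeration A) n → card (vecEnum E n) ≡ card E ^ n
vecEnum-card E zero    = refl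
vecEnum-card E (suc n) = begin
    ∑ (concatMap (λ y → map (y ∷_) (vecList (elems E) n)) (elems E)) (λ _ → 1)
  ≡⟨ ∑-concatMap (elems E) _ _ ⟩
    ∑ (elems E) (λ y → ∑ (map (y ∷_) (vecList (elems E) n)) (λ _ → 1))
  ≡⟨ ∑-cong (elems E) (λ y → trans (∑-map (vecList (elems E) n) _ _) (vecEnum-card E n)) ⟩
    ∑ (elems E) (λ _ → card E ^ n)
  ≡⟨ ∑-cong (elems E) (λ _ → sym (*-identityˡ (card E ^ n))) ⟩
    ∑ (elems E) (λ _ → 1 * card E ^ n)
  ≡⟨ ∑-*ʳ (elems E) (card E ^ n) (λ _ → 1) ⟩
    card E * card E ^ n ∎
  where open ≡-Reasoning

module _ (DS : DecSetoid 0ℓ 0ℓ) where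
  open DecSetoid DS using (Carrier; _≈_; _≟_) renaming (sym to ≈-sym; trans to ≈-trans)
  open UniqueDecSetoid DS using (Unique)

  ∑-unique : ∀ (L : List Carrier) {y} → Unique L → Any (y ≈_) L → ∑ L (λ E → ⌊ y ≟ E ⌋) ≡ 1
  ∑-unique (E ∷ L) {y} (E≉L ∷ _) (here y≈E) = cong₂ _+_ (cong ⟦_⟧ (dec-true (y ≟ E) y≈E)) rest-zero
    where
    excluded : ∀ {E'} → E' ∈ L → ¬ y ≈ E'
    excluded E'∈L y≈E' = allLookup E≉L E'∈L (≈-trans (≈-sym y≈E) y≈E')
    rest-zero : ∑ L (λ E' → ⌊ y ≟ E' ⌋) ≡ 0
    rest-zero = trans (∑-cong-∈ L (λ E'∈L → cong ⟦_⟧ (dec-false (y ≟ _) (excluded E'∈L)))) (∑-zero L (λ _ → refl))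
  ∑-unique (E ∷ L) {y} (E≉L ∷ uniq) (there y∈L) with find y∈L
  ... | E' , E'∈L , y≈E' = cong₂ _+_ (cong ⟦_⟧ (dec-false (y ≟ E) excluded)) (∑-unique L uniq y∈L)
    where
    excluded : ¬ y ≈ E
    excluded y≈E = allLookup E≉L E'∈L (≈-trans (≈-sym y≈E) y≈E')

module VectorSpace {q : ℕ} (F : FiniteField q) where

  open FiniteField F using (Carrier; 0#; 1#; -_; 0≢1; inverse; enumeration; isCommutativeRing)
    renaming (_+_ to _+ᶠ_; _*_ to _*ᶠ_)
  open LinearAlgebra F
  open IsSubspace

  module R = IsCommutativeRing isCommutativeRing

  private
    ring : CommutativeRing 0ℓ 0ℓ
    ring = record { isCommutativeRing = isCommutativeRing }
    open RingProperties (CommutativeRing.ring ring) using (-‿distribˡ-*)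
    open AbelianGroupProperties (CommutativeRing.+-abelianGroup ring) using (⁻¹-involutive; ⁻¹-∙-comm; ε⁻¹≈ε)

  infixl 6 _⊞_ _⊟_
  infixr 7 _⊡_
  infix 8 ⊝_

  _⊞_ : ∀ {n} → V n → V n → V n
  _⊞_ = _+v_

  _⊡_ : ∀ {n} → Carrier → V n → V n
  _⊡_ = _·v_

  ⊝_ : ∀ {n} → V n → V n
  ⊝_ = Data.Vec.map -_

  _⊟_ : ∀ {n} → V n → V n → V n
  x ⊟ y = x ⊞ ⊝ y

  ⊞-assoc : ∀ {n} (x y z : V n) → (x ⊞ y) ⊞ z ≡ x ⊞ (y ⊞ z)
  ⊞-assoc = Vecₚ.zipWith-assoc R.+-assoc

  ⊞-comm : ∀ {n} (x y : V n) → x ⊞ y ≡ y ⊞ x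
  ⊞-comm = Vecₚ.zipWith-comm R.+-comm

  ⊞-identityˡ : ∀ {n} (x : V n) → 0v ⊞ x ≡ x
  ⊞-identityˡ = Vecₚ.zipWith-identityˡ R.+-identityˡ

  ⊞-identityʳ : ∀ {n} (x : V n) → x ⊞ 0v ≡ x
  ⊞-identityʳ = Vecₚ.zipWith-identityʳ R.+-identityʳ

  ⊞-inverseˡ : ∀ {n} (x : V n) → ⊝ x ⊞ x ≡ 0v
  ⊞-inverseˡ = Vecₚ.zipWith-inverseˡ R.-‿inverseˡ

  ⊞-inverseʳ : ∀ {n} (x : V n) → x ⊟ x ≡ 0v
  ⊞-inverseʳ = Vecₚ.zipWith-inverseʳ R.-‿inverseʳ

  ⊝-distrib-⊞ : ∀ {n} (x y : V n) → ⊝ (x ⊞ y) ≡ ⊝ x ⊞ ⊝ y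
  ⊝-distrib-⊞ []      []      = refl
  ⊝-distrib-⊞ (a ∷ x) (b ∷ y) = cong₂ _∷_ (sym (⁻¹-∙-comm a b)) (⊝-distrib-⊞ x y)

  ⊞-interchange : ∀ {n} (a b c d : V n) → (a ⊞ b) ⊞ (c ⊞ d) ≡ (a ⊞ c) ⊞ (b ⊞ d)
  ⊞-interchange a b c d = begin
      (a ⊞ b) ⊞ (c ⊞ d) ≡⟨ ⊞-assoc a b (c ⊞ d) ⟩
      a ⊞ (b ⊞ (c ⊞ d)) ≡⟨ cong (a ⊞_) (sym (⊞-assoc b c d)) ⟩
      a ⊞ ((b ⊞ c) ⊞ d) ≡⟨ cong (λ w → a ⊞ (w ⊞ d)) (⊞-comm b c) ⟩
      a ⊞ ((c ⊞ b) ⊞ d) ≡⟨ cong (a ⊞_) (⊞-assoc c b d) ⟩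
      a ⊞ (c ⊞ (b ⊞ d)) ≡⟨ sym (⊞-assoc a c (b ⊞ d)) ⟩
      (a ⊞ c) ⊞ (b ⊞ d) ∎
    where open ≡-Reasoning

  ⊞-solveʳ : ∀ {n} (x y z : V n) → x ⊞ y ≡ z → y ≡ z ⊟ x
  ⊞-solveʳ x y z e = begin
      y               ≡⟨ sym (⊞-identityˡ y) ⟩
      0v ⊞ y          ≡⟨ cong (_⊞ y) (sym (⊞-inverseˡ x)) ⟩
      (⊝ x ⊞ x) ⊞ y   ≡⟨ ⊞-assoc (⊝ x) x y ⟩
      ⊝ x ⊞ (x ⊞ y)   ≡⟨ cong (⊝ x ⊞_) e ⟩
      ⊝ x ⊞ z         ≡⟨ ⊞-comm (⊝ x) z ⟩
      z ⊟ x           ∎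
    where open ≡-Reasoning

  ⊞-⊟-cancel : ∀ {n} (x y : V n) → x ⊞ (y ⊟ x) ≡ y
  ⊞-⊟-cancel x y = begin
      x ⊞ (y ⊞ ⊝ x)   ≡⟨ cong (x ⊞_) (⊞-comm y (⊝ x)) ⟩
      x ⊞ (⊝ x ⊞ y)   ≡⟨ sym (⊞-assoc x (⊝ x) y) ⟩
      (x ⊟ x) ⊞ y     ≡⟨ cong (_⊞ y) (⊞-inverseʳ x) ⟩
      0v ⊞ y          ≡⟨ ⊞-identityˡ y ⟩
      y               ∎
    where open ≡-Reasoning

  ⊟-⊞-cancel : ∀ {n} (x y : V n) → (x ⊟ y) ⊞ y ≡ x
  ⊟-⊞-cancel x y = trans (⊞-assoc x (⊝ y) y) (trans (cong (x ⊞_) (⊞-inverseˡ y)) (⊞-identityʳ x))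

  ⊟≡0⇒≡ : ∀ {n} (x y : V n) → x ⊟ y ≡ 0v → x ≡ y
  ⊟≡0⇒≡ x y e = trans (sym (⊞-⊟-cancel y x)) (trans (cong (y ⊞_) e) (⊞-identityʳ y))

  ⊡-distribˡ : ∀ {n} k (x y : V n) → k ⊡ (x ⊞ y) ≡ k ⊡ x ⊞ k ⊡ y
  ⊡-distribˡ k []      []      = refl
  ⊡-distribˡ k (a ∷ x) (b ∷ y) = cong₂ _∷_ (R.distribˡ k a b) (⊡-distribˡ k x y)

  ⊡-distribʳ : ∀ {n} k l (x : V n) → (k +ᶠ l) ⊡ x ≡ k ⊡ x ⊞ l ⊡ x
  ⊡-distribʳ k l []      = refl
  ⊡-distribʳ k l (a ∷ x) = cong₂ _∷_ (R.distribʳ a k l) (⊡-distribʳ k l x)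

  ⊡-assoc : ∀ {n} k l (x : V n) → (k *ᶠ l) ⊡ x ≡ k ⊡ (l ⊡ x)
  ⊡-assoc k l x = trans (Vecₚ.map-cong (R.*-assoc k l) x) (Vecₚ.map-∘ (k *ᶠ_) (l *ᶠ_) x)

  ⊡-identity : ∀ {n} (x : V n) → 1# ⊡ x ≡ x
  ⊡-identity x = trans (Vecₚ.map-cong R.*-identityˡ x) (Vecₚ.map-id x)

  ⊡-zeroˡ : ∀ {n} (x : V n) → 0# ⊡ x ≡ 0v
  ⊡-zeroˡ []      = refl
  ⊡-zeroˡ (a ∷ x) = cong₂ _∷_ (R.zeroˡ a) (⊡-zeroˡ x)

  ⊡-zeroʳ : ∀ {n} k → k ⊡ (0v {n}) ≡ 0v
  ⊡-zeroʳ {n} k = trans (Vecₚ.map-replicate (k *ᶠ_) 0# n) (cong (replicate n) (R.zeroʳ k))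

  ⊡-minus-one : ∀ {n} (x : V n) → (- 1#) ⊡ x ≡ ⊝ x
  ⊡-minus-one x = Vecₚ.map-cong (λ a → trans (sym (-‿distribˡ-* 1# a)) (cong -_ (R.*-identityˡ a))) x

  isolate : ∀ {n} {k} (v w u : V n) → k ≢ 0# → k ⊡ v ⊞ w ≡ u → ∃ λ y → v ≡ y ⊡ u ⊟ y ⊡ w
  isolate {k = k} v w u k≢0 e with inverse k k≢0
  ... | y , ky≡1 = y , ⊞-solveʳ (y ⊡ w) v (y ⊡ u) (begin
      y ⊡ w ⊞ v               ≡⟨ ⊞-comm (y ⊡ w) v ⟩
      v ⊞ y ⊡ w               ≡⟨ cong (_⊞ y ⊡ w) (sym y⊡k⊡v≡v) ⟩
      y ⊡ (k ⊡ v) ⊞ y ⊡ w     ≡⟨ sym (⊡-distribˡ y (k ⊡ v) w) ⟩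
      y ⊡ (k ⊡ v ⊞ w)         ≡⟨ cong (y ⊡_) e ⟩
      y ⊡ u                   ∎)
    where
    open ≡-Reasoning
    y⊡k⊡v≡v : y ⊡ (k ⊡ v) ≡ v
    y⊡k⊡v≡v = trans (sym (⊡-assoc y k v)) (trans (cong (_⊡ v) (trans (R.*-comm y k) ky≡1)) (⊡-identity v))

  lc : ∀ {n j} → V j → Vec (V n) j → V n
  lc []      []      = 0v
  lc (k ∷ c) (v ∷ t) = k ⊡ v ⊞ lc c t

  lc-+ : ∀ {n j} (c c' : V j) (t : Vec (V n) j) → lc (c ⊞ c') t ≡ lc c t ⊞ lc c' t
  lc-+ []      []        []      = sym (⊞-identityˡ 0v)
  lc-+ (k ∷ c) (k' ∷ c') (v ∷ t) =
    trans (cong₂ _⊞_ (⊡-distribʳ k k' v) (lc-+ c c' t)) (⊞-interchange _ _ _ _)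

  lc-⊡ : ∀ {n j} k (c : V j) (t : Vec (V n) j) → lc (k ⊡ c) t ≡ k ⊡ lc c t
  lc-⊡ k []      []      = sym (⊡-zeroʳ k)
  lc-⊡ k (a ∷ c) (v ∷ t) = trans (cong₂ _⊞_ (⊡-assoc k a v) (lc-⊡ k c t)) (sym (⊡-distribˡ k _ _))

  lc-0 : ∀ {n j} (t : Vec (V n) j) → lc 0v t ≡ 0v
  lc-0 []      = refl
  lc-0 (v ∷ t) = trans (cong₂ _⊞_ (⊡-zeroˡ v) (lc-0 t)) (⊞-identityˡ 0v)

  lc-⊟ : ∀ {n j} (c c' : V j) (t : Vec (V n) j) → lc (c ⊟ c') t ≡ lc c t ⊟ lc c' t
  lc-⊟ c c' t = begin
      lc (c ⊞ ⊝ c') t                ≡⟨ cong (λ w → lc (c ⊞ w) t) (sym (⊡-minus-one c')) ⟩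
      lc (c ⊞ (- 1#) ⊡ c') t         ≡⟨ lc-+ c _ t ⟩
      lc c t ⊞ lc ((- 1#) ⊡ c') t    ≡⟨ cong (lc c t ⊞_) (trans (lc-⊡ (- 1#) c' t) (⊡-minus-one _)) ⟩
      lc c t ⊟ lc c' t               ∎
    where open ≡-Reasoning

  Fenum : Enumeration Carrier
  Fenum = bijEnum enumeration

  Venum : ∀ n → Enumeration (V n)
  Venum n = vecEnum Fenum n

  elemsV : ∀ n → List (V n)
  elemsV n = elems (Venum n)

  _≟F_ : (x y : Carrier) → Dec (x ≡ y)
  _≟F_ = Enumeration._≟_ Fenum

  _≟V_ : ∀ {n} → (x y : V n) → Dec (x ≡ y)
  _≟V_ {n} = Enumeration._≟_ (Venum n)

  card-V : ∀ n → card (Venum n) ≡ q ^ n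
  card-V n = trans (vecEnum-card Fenum n) (cong (_^ n) (bijEnum-card enumeration))

  _∋?_ : ∀ {n} (S : SubsetV n) (x : V n) → Dec (S ∋ x)
  S ∋? x = S x because reflects (S x)
    where
    reflects : ∀ b → Reflects (b ≡ true) b
    reflects true  = ofʸ refl
    reflects false = ofⁿ (λ ())

  ∋-cong : ∀ {n m} (S : SubsetV n) (T : SubsetV m) {x y} → (S ∋ x → T ∋ y) → (T ∋ y → S ∋ x) → S x ≡ T y
  ∋-cong S T = true-iff

  _≐?_ : ∀ {n} (S T : SubsetV n) → Dec (S ≐ T)
  _≐?_ {n} S T = map′ (λ agree x → allLookup agree (complete (Venum n) x)) (λ S≐T → allTabulate (λ {x} _ → S≐T x))
                      (all? (λ x → S x Bool.≟ T x) (elemsV n))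

  subsetDecSetoid : ℕ → DecSetoid 0ℓ 0ℓ
  subsetDecSetoid n = record
    { Carrier          = SubsetV n
    ; _≈_              = _≐_
    ; isDecEquivalence = record
      { isEquivalence = record { refl = λ _ → refl ; sym = λ e x → sym (e x) ; trans = λ e f x → trans (e x) (f x) }
      ; _≟_           = _≐?_ } }

  ⊝-closed : ∀ {n} {S : SubsetV n} → IsSubspace S → ∀ {x} → S ∋ x → S ∋ (⊝ x)
  ⊝-closed {S = S} sS {x} x∈S = subst (S ∋_) (⊡-minus-one x) (·-closed sS (- 1#) x x∈S)

  ⊟-closed : ∀ {n} {S : SubsetV n} → IsSubspace S → ∀ {x y} → S ∋ x → S ∋ y → S ∋ (x ⊟ y)
  ⊟-closed sS {x} {y} x∈S y∈S = +-closed sS x (⊝ y) x∈S (⊝-closed sS y∈S)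

  lc-closed : ∀ {n j} {S : SubsetV n} → IsSubspace S → (c : V j) (t : Vec (V n) j) →
              All (S ∋_) t → S ∋ lc c t
  lc-closed sS []      []      []         = zero-mem sS
  lc-closed sS (k ∷ c) (v ∷ t) (v∈S ∷ t⊆S) = +-closed sS _ _ (·-closed sS k v v∈S) (lc-closed sS c t t⊆S)

  span : ∀ {n j} → Vec (V n) j → SubsetV n
  span {j = j} t x = does (anyᴸ? (λ c → lc c t ≟V x) (elemsV j))

  span-intro : ∀ {n j} (c : V j) (t : Vec (V n) j) → span t ∋ lc c t
  span-intro {j = j} c t = dec-true (anyᴸ? _ (elemsV j)) (anyMap (λ c≡c' → cong (λ c' → lc c' t) (sym c≡c')) (complete (Venum j) c))

  span-elim : ∀ {n j} (t : Vec (V n) j) {x} → span t ∋ x → ∃ λ c → lc c t ≡ x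
  span-elim {j = j} t x∈span = satisfied (does-sound (anyᴸ? _ (elemsV j)) x∈span)

  span-subspace : ∀ {n j} (t : Vec (V n) j) → IsSubspace (span t)
  span-subspace t = record
    { zero-mem = subst (span t ∋_) (lc-0 t) (span-intro 0v t)
    ; +-closed = λ x y x∈ y∈ → plus (span-elim t x∈) (span-elim t y∈)
    ; ·-closed = λ k x x∈ → times k (span-elim t x∈) }
    where
    plus : ∀ {x y} → (∃ λ c → lc c t ≡ x) → (∃ λ c → lc c t ≡ y) → span t ∋ (x ⊞ y)
    plus (c , refl) (c' , refl) = subst (span t ∋_) (lc-+ c c' t) (span-intro (c ⊞ c') t)
    times : ∀ k {x} → (∃ λ c → lc c t ≡ x) → span t ∋ (k ⊡ x)
    times k (c , refl) = subst (span t ∋_) (lc-⊡ k c t) (span-intro (k ⊡ c) t)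

  span-⊆-∷ : ∀ {n j} (v : V n) (t : Vec (V n) j) {x} → span t ∋ x → span (v ∷ t) ∋ x
  span-⊆-∷ v t x∈ with span-elim t x∈
  ... | c , refl = subst (span (v ∷ t) ∋_) (trans (cong (_⊞ lc c t) (⊡-zeroˡ v)) (⊞-identityˡ _)) (span-intro (0# ∷ c) (v ∷ t))

  span-head : ∀ {n j} (v : V n) (t : Vec (V n) j) → span (v ∷ t) ∋ v
  span-head v t = subst (span (v ∷ t) ∋_) (trans (cong₂ _⊞_ (⊡-identity v) (lc-0 t)) (⊞-identityʳ v)) (span-intro (1# ∷ 0v) (v ∷ t))

  span-entries : ∀ {n j} (t : Vec (V n) j) → All (span t ∋_) t
  span-entries []      = []
  span-entries (v ∷ t) = span-head v t ∷ allMap (span-⊆-∷ v t) (span-entries t)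

  span-[] : ∀ {n} {x : V n} → span [] ∋ x → x ≡ 0v
  span-[] x∈ with span-elim [] x∈
  ... | [] , e = sym e

  _⊕_ : ∀ {n} → SubsetV n → SubsetV n → SubsetV n
  _⊕_ {n} X Y z = does (anyᴸ? (λ x → X ∋? x ×-dec Y ∋? (z ⊟ x)) (elemsV n))

  ⊕-intro : ∀ {n} (X Y : SubsetV n) {x y} → X ∋ x → Y ∋ y → (X ⊕ Y) ∋ (x ⊞ y)
  ⊕-intro {n} X Y {x} {y} x∈X y∈Y = dec-true (anyᴸ? _ (elemsV n))
    (anyMap (λ { refl → x∈X , subst (Y ∋_) (⊞-solveʳ x y _ refl) y∈Y }) (complete (Venum n) x))

  ⊕-elim : ∀ {n} (X Y : SubsetV n) {z} → (X ⊕ Y) ∋ z → ∃ λ x → ∃ λ y → X ∋ x × Y ∋ y × x ⊞ y ≡ z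
  ⊕-elim {n} X Y {z} z∈ with satisfied (does-sound (anyᴸ? _ (elemsV n)) z∈)
  ... | x , x∈X , z-x∈Y = x , z ⊟ x , x∈X , z-x∈Y , ⊞-⊟-cancel x z

  ⊕-inclˡ : ∀ {n} (X Y : SubsetV n) → IsSubspace Y → ∀ {x} → X ∋ x → (X ⊕ Y) ∋ x
  ⊕-inclˡ X Y sY {x} x∈X = subst ((X ⊕ Y) ∋_) (⊞-identityʳ x) (⊕-intro X Y x∈X (zero-mem sY))

  ⊕-inclʳ : ∀ {n} (X Y : SubsetV n) → IsSubspace X → ∀ {y} → Y ∋ y → (X ⊕ Y) ∋ y
  ⊕-inclʳ X Y sX {y} y∈Y = subst ((X ⊕ Y) ∋_) (⊞-identityˡ y) (⊕-intro X Y (zero-mem sX) y∈Y)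

  ⊕-subspace : ∀ {n} (X Y : SubsetV n) → IsSubspace X → IsSubspace Y → IsSubspace (X ⊕ Y)
  ⊕-subspace X Y sX sY = record
    { zero-mem = ⊕-inclˡ X Y sY (zero-mem sX)
    ; +-closed = λ z z' z∈ z'∈ → plus (⊕-elim X Y z∈) (⊕-elim X Y z'∈)
    ; ·-closed = λ k z z∈ → times k (⊕-elim X Y z∈) }
    where
    Decomp : _ → Set
    Decomp z = ∃ λ x → ∃ λ y → X ∋ x × Y ∋ y × x ⊞ y ≡ z
    plus : ∀ {z z'} → Decomp z → Decomp z' → (X ⊕ Y) ∋ (z ⊞ z')
    plus (x , y , x∈ , y∈ , refl) (x' , y' , x'∈ , y'∈ , refl) =
      subst ((X ⊕ Y) ∋_) (sym (⊞-interchange x y x' y'))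
        (⊕-intro X Y (+-closed sX _ _ x∈ x'∈) (+-closed sY _ _ y∈ y'∈))
    times : ∀ k {z} → Decomp z → (X ⊕ Y) ∋ (k ⊡ z)
    times k (x , y , x∈ , y∈ , refl) =
      subst ((X ⊕ Y) ∋_) (sym (⊡-distribˡ k x y)) (⊕-intro X Y (·-closed sX k x x∈) (·-closed sY k y y∈))

  ∩-char : ∀ {n} (S T : SubsetV n) x → (S ∩ T) x ≡ S x ∧ T x
  ∩-char S T x with S x
  ... | true  = refl
  ... | false = refl

  ∩-intro : ∀ {n} (S T : SubsetV n) {x} → S ∋ x → T ∋ x → (S ∩ T) ∋ x
  ∩-intro S T {x} x∈S x∈T = trans (∩-char S T x) (cong₂ _∧_ x∈S x∈T)

  ∩-elimˡ : ∀ {n} (S T : SubsetV n) {x} → (S ∩ T) ∋ x → S ∋ x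
  ∩-elimˡ S T {x} x∈ = ∧-conicalˡ (S x) (T x) (trans (sym (∩-char S T x)) x∈)

  ∩-elimʳ : ∀ {n} (S T : SubsetV n) {x} → (S ∩ T) ∋ x → T ∋ x
  ∩-elimʳ S T {x} x∈ = ∧-conicalʳ (S x) (T x) (trans (sym (∩-char S T x)) x∈)

  Independent : ∀ {n j} → Vec (V n) j → Set
  Independent {j = j} t = ∀ (c : V j) → lc c t ≡ 0v → c ≡ 0v

  independent-[] : ∀ {n} → Independent {n} []
  independent-[] [] _ = refl

  independent-tail : ∀ {n j} (v : V n) (t : Vec (V n) j) → Independent (v ∷ t) → Independent t
  independent-tail v t ind c e =
    Vecₚ.∷-injectiveʳ (ind (0# ∷ c) (trans (cong₂ _⊞_ (⊡-zeroˡ v) e) (⊞-identityˡ 0v)))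

  independent-head : ∀ {n j} (v : V n) (t : Vec (V n) j) → Independent (v ∷ t) → ¬ span t ∋ v
  independent-head v t ind v∈ with span-elim t v∈
  ... | c , e = -1≢0 (Vecₚ.∷-injectiveˡ (ind (- 1# ∷ c) (trans (cong₂ _⊞_ (⊡-minus-one v) e) (⊞-inverseˡ v))))
    where
    -1≢0 : - 1# ≢ 0#
    -1≢0 e = 0≢1 (sym (trans (sym (⁻¹-involutive 1#)) (trans (cong -_ e) ε⁻¹≈ε)))

  independent-∷ : ∀ {n j} (v : V n) (t : Vec (V n) j) → Independent t → ¬ span t ∋ v → Independent (v ∷ t)
  independent-∷ v t ind v∉ (k ∷ c) e with k ≟F 0#
  ... | yes refl = cong₂ _∷_ refl (ind c (trans (sym (trans (cong (_⊞ lc c t) (⊡-zeroˡ v)) (⊞-identityˡ _))) e))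
  ... | no  k≢0 with isolate v (lc c t) 0v k≢0 e
  ...   | y , v≡ = ⊥-elim (v∉ (subst (span t ∋_) (sym v≡)
            (⊟-closed sT (·-closed sT y 0v (zero-mem sT)) (·-closed sT y _ (span-intro c t)))))
    where sT = span-subspace t

  triv-[] : ∀ {n} (A : SubsetV n) → TrivialIntersection (span []) A
  triv-[] A x x∈ _ = span-[] x∈

  triv-tail : ∀ {n j} (A : SubsetV n) (v : V n) (t : Vec (V n) j) →
              TrivialIntersection (span (v ∷ t)) A → TrivialIntersection (span t) A
  triv-tail A v t triv x x∈ = triv x (span-⊆-∷ v t x∈)

  triv-∷ : ∀ {n j} (A : SubsetV n) → IsSubspace A → (v : V n) (t : Vec (V n) j) →
           TrivialIntersection (span t) A → ¬ (span t ⊕ A) ∋ v → TrivialIntersection (span (v ∷ t)) A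
  triv-∷ A sA v t triv v∉ x x∈ x∈A with span-elim (v ∷ t) x∈
  ... | (k ∷ c) , refl with k ≟F 0#
  ...   | yes refl = trans drop-v (triv _ (span-intro c t) (subst (A ∋_) drop-v x∈A))
    where
    drop-v : 0# ⊡ v ⊞ lc c t ≡ lc c t
    drop-v = trans (cong (_⊞ lc c t) (⊡-zeroˡ v)) (⊞-identityˡ _)
  ...   | no  k≢0 with isolate v (lc c t) _ k≢0 refl
  ...     | y , v≡ = ⊥-elim (v∉ (subst ((span t ⊕ A) ∋_) (sym (trans v≡ (⊞-comm _ _)))
              (⊕-intro (span t) A (⊝-closed sT (·-closed sT y _ (span-intro c t)))
                                  (·-closed sA y _ x∈A))))
    where sT = span-subspace t

  triv-head : ∀ {n j} (A : SubsetV n) (v : V n) (t : Vec (V n) j) →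
              TrivialIntersection (span (v ∷ t)) A → ¬ span t ∋ v → ¬ (span t ⊕ A) ∋ v
  triv-head A v t triv v∉ v∈ with ⊕-elim (span t) A v∈
  ... | w , a , w∈ , a∈A , w+a≡v = v∉ (subst (span t ∋_) w≡v w∈)
    where
    a∈span : span (v ∷ t) ∋ a
    a∈span = subst (span (v ∷ t) ∋_) (sym (⊞-solveʳ w a v w+a≡v))
               (⊟-closed (span-subspace (v ∷ t)) (span-head v t) (span-⊆-∷ v t w∈))
    w≡v : w ≡ v
    w≡v = trans (sym (⊞-identityʳ w)) (trans (cong (w ⊞_) (sym (triv a a∈span a∈A))) w+a≡v)

  -- For a decidable step condition Q, a chain is a list (v_j, …, v_1) in which
  -- every v_i satisfies Q relative to the list (v_{i-1}, …, v_1) before it.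
  Chain : ∀ {n} (Q : ∀ {j} → Vec (V n) j → V n → Set) →
          (∀ {j} (t : Vec (V n) j) v → Dec (Q t v)) → ∀ {j} → Vec (V n) j → Bool
  Chain Q Q? []      = true
  Chain Q Q? (v ∷ t) = Chain Q Q? t ∧ does (Q? t v)

  module _ {n} (Q : ∀ {j} → Vec (V n) j → V n → Set) (Q? : ∀ {j} (t : Vec (V n) j) v → Dec (Q t v)) where

    chain-∷⁻ : ∀ {j} v (t : Vec (V n) j) → Chain Q Q? (v ∷ t) ≡ true → Chain Q Q? t ≡ true × Q t v
    chain-∷⁻ v t ch = ∧-conicalˡ _ _ ch , does-sound (Q? t v) (∧-conicalʳ _ _ ch)

    chain-∷⁺ : ∀ {j} v (t : Vec (V n) j) → Chain Q Q? t ≡ true → Q t v → Chain Q Q? (v ∷ t) ≡ true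
    chain-∷⁺ v t ch q = cong₂ _∧_ ch (dec-true (Q? t v) q)

  FreshIn : ∀ {n} (E : SubsetV n) → ∀ {j} → Vec (V n) j → V n → Set
  FreshIn E t v = E ∋ v × ¬ span t ∋ v

  freshIn? : ∀ {n} (E : SubsetV n) → ∀ {j} (t : Vec (V n) j) v → Dec (FreshIn E t v)
  freshIn? E t v = E ∋? v ×-dec ¬? (span t ∋? v)

  fresh-chain⇒ : ∀ {n} (E : SubsetV n) {j} (t : Vec (V n) j) →
                 Chain (FreshIn E) (freshIn? E) t ≡ true → Independent t × All (E ∋_) t
  fresh-chain⇒ E []      _  = independent-[] , []
  fresh-chain⇒ E (v ∷ t) ch with chain-∷⁻ (FreshIn E) (freshIn? E) v t ch
  ... | ch' , v∈E , v∉ with fresh-chain⇒ E t ch'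
  ...   | ind , t⊆E = independent-∷ v t ind v∉ , v∈E ∷ t⊆E

  fresh-chain⇐ : ∀ {n} (E : SubsetV n) {j} (t : Vec (V n) j) →
                 Independent t → All (E ∋_) t → Chain (FreshIn E) (freshIn? E) t ≡ true
  fresh-chain⇐ E []      _   _            = refl
  fresh-chain⇐ E (v ∷ t) ind (v∈E ∷ t⊆E) = chain-∷⁺ (FreshIn E) (freshIn? E) v t
    (fresh-chain⇐ E t (independent-tail v t ind) t⊆E) (v∈E , independent-head v t ind)

  Avoiding : ∀ {n} (A B : SubsetV n) → ∀ {j} → Vec (V n) j → V n → Set
  Avoiding A B t v = ¬ (span t ⊕ A) ∋ v × ¬ (span t ⊕ B) ∋ v

  avoiding? : ∀ {n} (A B : SubsetV n) → ∀ {j} (t : Vec (V n) j) v → Dec (Avoiding A B t v)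
  avoiding? A B t v = ¬? ((span t ⊕ A) ∋? v) ×-dec ¬? ((span t ⊕ B) ∋? v)

  avoiding-chain⇒ : ∀ {n} {A B : SubsetV n} → IsSubspace A → IsSubspace B → ∀ {j} (t : Vec (V n) j) →
                    Chain (Avoiding A B) (avoiding? A B) t ≡ true →
                    Independent t × TrivialIntersection (span t) A × TrivialIntersection (span t) B
  avoiding-chain⇒ {A = A} {B} sA sB []      _  = independent-[] , triv-[] A , triv-[] B
  avoiding-chain⇒ {A = A} {B} sA sB (v ∷ t) ch with chain-∷⁻ (Avoiding A B) (avoiding? A B) v t ch
  ... | ch' , v∉A , v∉B with avoiding-chain⇒ sA sB t ch'
  ...   | ind , trivA , trivB =
    independent-∷ v t ind (λ v∈ → v∉A (⊕-inclˡ (span t) A sA v∈)) ,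
    triv-∷ A sA v t trivA v∉A , triv-∷ B sB v t trivB v∉B

  avoiding-chain⇐ : ∀ {n} {A B : SubsetV n} → ∀ {j} (t : Vec (V n) j) → Independent t →
                    TrivialIntersection (span t) A → TrivialIntersection (span t) B →
                    Chain (Avoiding A B) (avoiding? A B) t ≡ true
  avoiding-chain⇐ []      _   _     _     = refl
  avoiding-chain⇐ {A = A} {B} (v ∷ t) ind trivA trivB = chain-∷⁺ (Avoiding A B) (avoiding? A B) v t
    (avoiding-chain⇐ t (independent-tail v t ind) (triv-tail A v t trivA) (triv-tail B v t trivB))
    (triv-head A v t trivA v∉ , triv-head B v t trivB v∉)
    where v∉ = independent-head v t ind

module Counting {q : ℕ} (F : FiniteField q) where

  open LinearAlgebra F
  open VectorSpace F
  open IsSubspace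

  module EV n = Enumeration (Venum n)

  ∣_∣ : ∀ {n} → SubsetV n → ℕ
  ∣_∣ {n} S = ∑ (elemsV n) (λ x → ⟦ S x ⟧)

  -- a subspace with a basis of k vectors has q^k elements, because every
  -- element has exactly one coordinate vector in F^k
  size-basis : ∀ {n k} {S : SubsetV n} → IsSubspace S → (t : Vec (V n) k) → All (S ∋_) t →
               Independent t → (∀ x → S ∋ x → ∃ λ c → lc c t ≡ x) → ∣ S ∣ ≡ q ^ k
  size-basis {n} {k} {S} sS t t⊆S ind spans = begin
      ∑ (elemsV n) (λ x → ⟦ S x ⟧)                                  ≡⟨ ∑-cong (elemsV n) coordinates ⟩
      ∑ (elemsV n) (λ x → ∑ (elemsV k) (λ c → EV.δ n (lc c t) x))   ≡⟨ ∑-swap (elemsV n) (elemsV k) _ ⟩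
      ∑ (elemsV k) (λ c → ∑ (elemsV n) (EV.δ n (lc c t)))           ≡⟨ ∑-cong (elemsV k) (λ c → EV.exact n (lc c t)) ⟩
      card (Venum k)                                                ≡⟨ card-V k ⟩
      q ^ k                                                         ∎
    where
    open ≡-Reasoning
    lc-injective : ∀ {c c'} → lc c t ≡ lc c' t → c' ≡ c
    lc-injective {c} {c'} e =
      sym (⊟≡0⇒≡ c c' (ind (c ⊟ c') (trans (lc-⊟ c c' t) (trans (cong (_⊟ lc c' t) e) (⊞-inverseʳ _)))))
    coordinates : ∀ x → ⟦ S x ⟧ ≡ ∑ (elemsV k) (λ c → EV.δ n (lc c t) x)
    coordinates x with true? (S x)
    ... | inj₁ x∈S with spans x x∈S
    ...   | c₀ , refl = trans (cong ⟦_⟧ x∈S) (sym (trans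
            (∑-cong (elemsV k) (λ c → ⌊⌋-cong (lc c t ≟V lc c₀ t) (c₀ ≟V c) lc-injective (λ { refl → refl })))
            (EV.exact k c₀)))
    coordinates x | inj₂ x∉S = trans (⟦⟧-false x∉S) (sym (∑-zero (elemsV k)
      (λ c → EV.δ-≢ n (λ e → x∉S (subst (S ∋_) e (lc-closed sS c t t⊆S))))))

  size-span : ∀ {n j} (t : Vec (V n) j) → Independent t → ∣ span t ∣ ≡ q ^ j
  size-span t ind = size-basis (span-subspace t) t (span-entries t) ind (λ x → span-elim t)

  size-zero : ∀ {n} (S : SubsetV n) → S ∋ 0v → (∀ x → S ∋ x → x ≡ 0v) → ∣ S ∣ ≡ 1
  size-zero {n} S 0∈S only-0 = trans
    (∑-cong (elemsV n) (λ x → ⌊⌋-cong (S ∋? x) (0v ≟V x) (λ x∈S → sym (only-0 x x∈S)) (λ { refl → 0∈S })))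
    (EV.exact n 0v)

  size-all : ∀ {n} (S : SubsetV n) → (∀ x → S ∋ x) → ∣ S ∣ ≡ q ^ n
  size-all {n} S all = trans (∑-cong (elemsV n) (λ x → cong ⟦_⟧ (all x))) (card-V n)

  size-mono : ∀ {n} (S T : SubsetV n) → (∀ x → S ∋ x → T ∋ x) → ∣ S ∣ ≤ ∣ T ∣
  size-mono {n} S T S⊆T = ∑-mono (elemsV n) (λ x → ⟦⟧-mono (S⊆T x))

  size-≤ : ∀ {n} (S : SubsetV n) → ∣ S ∣ ≤ q ^ n
  size-≤ {n} S = subst (∣ S ∣ ≤_) (size-all {n} _ (λ _ → refl)) (size-mono S _ (λ _ _ → refl))

  size-⊆-tight : ∀ {n} (S T : SubsetV n) → (∀ x → S ∋ x → T ∋ x) → ∣ T ∣ ≤ ∣ S ∣ → ∀ x → T ∋ x → S ∋ x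
  size-⊆-tight {n} S T S⊆T T≤S x x∈T = ⟦⟧≡1⇒true (trans
    (∑-mono-tight (elemsV n) (λ y → ⟦⟧-mono (S⊆T y)) (≤-antisym (size-mono S T S⊆T) T≤S) (complete (Venum n) x))
    (cong ⟦_⟧ x∈T))

  size-full : ∀ {n} (S : SubsetV n) → q ^ n ≤ ∣ S ∣ → ∀ x → S ∋ x
  size-full {n} S q^n≤S x = size-⊆-tight S (λ _ → true) (λ _ _ → refl)
    (subst (_≤ ∣ S ∣) (sym (size-all {n} _ (λ _ → refl))) q^n≤S) x refl

  ∑-translate : ∀ {n} (a : V n) (f : V n → ℕ) → ∑ (elemsV n) (λ w → f (a ⊞ w)) ≡ ∑ (elemsV n) f
  ∑-translate {n} a f = begin
      ∑ (elemsV n) (λ w → f (a ⊞ w))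
    ≡⟨ ∑-cong (elemsV n) (λ w → sym (EV.pick n (a ⊞ w) f)) ⟩
      ∑ (elemsV n) (λ w → ∑ (elemsV n) (λ u → EV.δ n (a ⊞ w) u * f u))
    ≡⟨ ∑-swap (elemsV n) (elemsV n) _ ⟩
      ∑ (elemsV n) (λ u → ∑ (elemsV n) (λ w → EV.δ n (a ⊞ w) u * f u))
    ≡⟨ ∑-cong (elemsV n) (λ u → trans (∑-*ʳ (elemsV n) (f u) _) (trans (cong (_* f u) (hits u)) (*-identityˡ (f u)))) ⟩
      ∑ (elemsV n) f
    ∎
    where
    open ≡-Reasoning
    hits : ∀ u → ∑ (elemsV n) (λ w → EV.δ n (a ⊞ w) u) ≡ 1
    hits u = trans (∑-cong (elemsV n) (λ w → ⌊⌋-cong ((a ⊞ w) ≟V u) ((u ⊟ a) ≟V w)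
                      (λ e → sym (⊞-solveʳ a w u e)) (λ { refl → ⊞-⊟-cancel a u })))
                   (EV.exact n (u ⊟ a))

  decompositions : ∀ {n} → SubsetV n → SubsetV n → V n → ℕ
  decompositions {n} X Y z = ∑ (elemsV n) (λ x → ⟦ X x ⟧ * ⟦ Y (z ⊟ x) ⟧)

  -- every z ∈ X + Y has exactly |X ∩ Y| decompositions: they are z = (x₀ + w) + (y₀ - w), w ∈ X ∩ Y
  decompositions-count : ∀ {n} (X Y : SubsetV n) → IsSubspace X → IsSubspace Y →
                         ∀ z → decompositions X Y z ≡ ⟦ (X ⊕ Y) z ⟧ * ∣ X ∩ Y ∣
  decompositions-count {n} X Y sX sY z with true? ((X ⊕ Y) z)
  ... | inj₂ z∉ = trans (∑-zero (elemsV n) none) (cong (_* ∣ X ∩ Y ∣) (sym (⟦⟧-false z∉)))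
    where
    none : ∀ x → ⟦ X x ⟧ * ⟦ Y (z ⊟ x) ⟧ ≡ 0
    none x = trans (sym (⟦∧⟧ (X x) (Y (z ⊟ x)))) (⟦⟧-false (λ both → z∉ (subst ((X ⊕ Y) ∋_) (⊞-⊟-cancel x z)
               (⊕-intro X Y (∧-conicalˡ _ _ both) (∧-conicalʳ _ _ both)))))
  ... | inj₁ z∈ with ⊕-elim X Y z∈
  ...   | x₀ , y₀ , x₀∈ , y₀∈ , refl = begin
      decompositions X Y (x₀ ⊞ y₀)
    ≡⟨ sym (∑-translate x₀ _) ⟩
      ∑ (elemsV n) (λ w → ⟦ X (x₀ ⊞ w) ⟧ * ⟦ Y ((x₀ ⊞ y₀) ⊟ (x₀ ⊞ w)) ⟧)
    ≡⟨ ∑-cong (elemsV n) shifted ⟩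
      ∣ X ∩ Y ∣
    ≡⟨ sym (*-identityˡ _) ⟩
      1 * ∣ X ∩ Y ∣
    ≡⟨ cong (λ b → ⟦ b ⟧ * ∣ X ∩ Y ∣) (sym z∈) ⟩
      ⟦ (X ⊕ Y) (x₀ ⊞ y₀) ⟧ * ∣ X ∩ Y ∣
    ∎
    where
    open ≡-Reasoning
    cancel-x₀ : ∀ w → (x₀ ⊞ y₀) ⊟ (x₀ ⊞ w) ≡ y₀ ⊟ w
    cancel-x₀ w = begin
        (x₀ ⊞ y₀) ⊞ ⊝ (x₀ ⊞ w)     ≡⟨ cong ((x₀ ⊞ y₀) ⊞_) (⊝-distrib-⊞ x₀ w) ⟩
        (x₀ ⊞ y₀) ⊞ (⊝ x₀ ⊞ ⊝ w)   ≡⟨ ⊞-interchange x₀ y₀ (⊝ x₀) (⊝ w) ⟩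
        (x₀ ⊟ x₀) ⊞ (y₀ ⊟ w)       ≡⟨ cong (_⊞ (y₀ ⊟ w)) (⊞-inverseʳ x₀) ⟩
        0v ⊞ (y₀ ⊟ w)              ≡⟨ ⊞-identityˡ _ ⟩
        y₀ ⊟ w                     ∎
    in-X : ∀ w → X (x₀ ⊞ w) ≡ X w
    in-X w = ∋-cong X X (λ m → subst (X ∋_) (sym (⊞-solveʳ x₀ w _ refl)) (⊟-closed sX m x₀∈))
                        (+-closed sX x₀ w x₀∈)
    in-Y : ∀ w → Y ((x₀ ⊞ y₀) ⊟ (x₀ ⊞ w)) ≡ Y w
    in-Y w = trans (cong Y (cancel-x₀ w)) (∋-cong Y Y
      (λ m → subst (Y ∋_) (sym (⊞-solveʳ (y₀ ⊟ w) w y₀ (⊟-⊞-cancel y₀ w))) (⊟-closed sY y₀∈ m))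
      (⊟-closed sY y₀∈))
    shifted : ∀ w → ⟦ X (x₀ ⊞ w) ⟧ * ⟦ Y ((x₀ ⊞ y₀) ⊟ (x₀ ⊞ w)) ⟧ ≡ ⟦ (X ∩ Y) w ⟧
    shifted w = trans (cong₂ (λ b b' → ⟦ b ⟧ * ⟦ b' ⟧) (in-X w) (in-Y w))
                      (trans (sym (⟦∧⟧ (X w) (Y w))) (cong ⟦_⟧ (sym (∩-char X Y w))))

  -- counting pairs (x, y) ∈ X × Y by their sum x + y
  product-formula : ∀ {n} (X Y : SubsetV n) → IsSubspace X → IsSubspace Y →
                    ∣ X ∣ * ∣ Y ∣ ≡ ∣ X ⊕ Y ∣ * ∣ X ∩ Y ∣
  product-formula {n} X Y sX sY = begin
      ∣ X ∣ * ∣ Y ∣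
    ≡⟨ sym (∑-*ʳ (elemsV n) ∣ Y ∣ (λ x → ⟦ X x ⟧)) ⟩
      ∑ (elemsV n) (λ x → ⟦ X x ⟧ * ∣ Y ∣)
    ≡⟨ ∑-cong (elemsV n) pairs-with-x ⟩
      ∑ (elemsV n) (λ x → ∑ (elemsV n) (λ z → ⟦ X x ⟧ * ⟦ Y (z ⊟ x) ⟧))
    ≡⟨ ∑-swap (elemsV n) (elemsV n) _ ⟩
      ∑ (elemsV n) (decompositions X Y)
    ≡⟨ ∑-cong (elemsV n) (decompositions-count X Y sX sY) ⟩
      ∑ (elemsV n) (λ z → ⟦ (X ⊕ Y) z ⟧ * ∣ X ∩ Y ∣)
    ≡⟨ ∑-*ʳ (elemsV n) ∣ X ∩ Y ∣ _ ⟩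
      ∣ X ⊕ Y ∣ * ∣ X ∩ Y ∣
    ∎
    where
    open ≡-Reasoning
    -- substituting y = z - x
    pairs-with-x : ∀ x → ⟦ X x ⟧ * ∣ Y ∣ ≡ ∑ (elemsV n) (λ z → ⟦ X x ⟧ * ⟦ Y (z ⊟ x) ⟧)
    pairs-with-x x = begin
        ⟦ X x ⟧ * ∣ Y ∣                                ≡⟨ cong (⟦ X x ⟧ *_) (sym (∑-translate (⊝ x) _)) ⟩
        ⟦ X x ⟧ * ∑ (elemsV n) (λ z → ⟦ Y (⊝ x ⊞ z) ⟧) ≡⟨ cong (⟦ X x ⟧ *_) (∑-cong (elemsV n) reorder) ⟩
        ⟦ X x ⟧ * ∑ (elemsV n) (λ z → ⟦ Y (z ⊟ x) ⟧)   ≡⟨ sym (∑-*ˡ (elemsV n) ⟦ X x ⟧ _) ⟩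
        ∑ (elemsV n) (λ z → ⟦ X x ⟧ * ⟦ Y (z ⊟ x) ⟧)   ∎
      where
      reorder : ∀ z → ⟦ Y (⊝ x ⊞ z) ⟧ ≡ ⟦ Y (z ⊟ x) ⟧
      reorder z = cong (λ u → ⟦ Y u ⟧) (⊞-comm (⊝ x) z)

  elemsT : ∀ n j → List (Vec (V n) j)
  elemsT n j = elems (vecEnum (Venum n) j)

  #chains : ∀ {n} (Q : ∀ {j} → Vec (V n) j → V n → Set) → (∀ {j} (t : Vec (V n) j) v → Dec (Q t v)) → ℕ → ℕ
  #chains {n} Q Q? j = ∑ (elemsT n j) (λ t → ⟦ Chain Q Q? t ⟧)

  #chains-suc : ∀ {n} (Q : ∀ {j} → Vec (V n) j → V n → Set) (Q? : ∀ {j} (t : Vec (V n) j) v → Dec (Q t v)) j g →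
                (∀ (t : Vec (V n) j) → Chain Q Q? t ≡ true → ∑ (elemsV n) (λ v → ⌊ Q? t v ⌋) ≡ g) →
                #chains Q Q? (suc j) ≡ #chains Q Q? j * g
  #chains-suc {n} Q Q? j g extensions = begin
      ∑ (concatMap (λ v → map (v ∷_) (elemsT n j)) (elemsV n)) (λ u → ⟦ Chain Q Q? u ⟧)
    ≡⟨ ∑-concatMap (elemsV n) _ _ ⟩
      ∑ (elemsV n) (λ v → ∑ (map (v ∷_) (elemsT n j)) (λ u → ⟦ Chain Q Q? u ⟧))
    ≡⟨ ∑-cong (elemsV n) (λ v → trans (∑-map (elemsT n j) (v ∷_) _) (∑-cong (elemsT n j) (λ t → ⟦∧⟧ (Chain Q Q? t) _))) ⟩
      ∑ (elemsV n) (λ v → ∑ (elemsT n j) (λ t → ⟦ Chain Q Q? t ⟧ * ⌊ Q? t v ⌋))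
    ≡⟨ ∑-swap (elemsV n) (elemsT n j) _ ⟩
      ∑ (elemsT n j) (λ t → ∑ (elemsV n) (λ v → ⟦ Chain Q Q? t ⟧ * ⌊ Q? t v ⌋))
    ≡⟨ ∑-cong (elemsT n j) (λ t → trans (∑-*ˡ (elemsV n) ⟦ Chain Q Q? t ⟧ _) (extend t)) ⟩
      ∑ (elemsT n j) (λ t → ⟦ Chain Q Q? t ⟧ * g)
    ≡⟨ ∑-*ʳ (elemsT n j) g _ ⟩
      #chains Q Q? j * g
    ∎
    where
    open ≡-Reasoning
    extend : ∀ t → ⟦ Chain Q Q? t ⟧ * ∑ (elemsV n) (λ v → ⌊ Q? t v ⌋) ≡ ⟦ Chain Q Q? t ⟧ * g
    extend t with true? (Chain Q Q? t)
    ... | inj₁ ch  = cong (⟦ Chain Q Q? t ⟧ *_) (extensions t ch)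
    ... | inj₂ ¬ch rewrite ⟦⟧-false ¬ch = refl

  -- a subspace E with q^d elements has  Π_{i<j} (q^d - q^i)  independent j-lists:
  -- an independent list t of length j can be extended by the q^d - q^j vectors of E ∖ span t
  #independent-lists : ∀ {n} (E : SubsetV n) d → IsSubspace E → ∣ E ∣ ≡ q ^ d →
                       ∀ j → #chains (FreshIn E) (freshIn? E) j ≡ prod j (λ i → q ^ d ∸ q ^ i)
  #independent-lists E d sE ∣E∣ zero    = refl
  #independent-lists {n} E d sE ∣E∣ (suc j) =
    trans (#chains-suc (FreshIn E) (freshIn? E) j _ extensions)
          (cong (_* (q ^ d ∸ q ^ j)) (#independent-lists E d sE ∣E∣ j))
    where
    extensions : ∀ (t : Vec (V n) j) → Chain (FreshIn E) (freshIn? E) t ≡ true →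
                 ∑ (elemsV n) (λ v → ⌊ freshIn? E t v ⌋) ≡ q ^ d ∸ q ^ j
    extensions t ch = trans (sym (m+n∸n≡m _ (q ^ j))) (cong (_∸ q ^ j) (begin
        ∑ (elemsV n) (λ v → ⌊ freshIn? E t v ⌋) + q ^ j
      ≡⟨ cong (∑ (elemsV n) (λ v → ⌊ freshIn? E t v ⌋) +_) (sym (size-span t ind)) ⟩
        ∑ (elemsV n) (λ v → ⌊ freshIn? E t v ⌋) + ∣ span t ∣
      ≡⟨ sym (∑-+ (elemsV n) _ _) ⟩
        ∑ (elemsV n) (λ v → ⌊ freshIn? E t v ⌋ + ⟦ span t v ⟧)
      ≡⟨ ∑-cong (elemsV n) (λ v → ⟦∧not⟧ (E v) (span t v) (span⊆E v)) ⟩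
        ∣ E ∣
      ≡⟨ ∣E∣ ⟩
        q ^ d
      ∎))
      where
      open ≡-Reasoning
      ind = proj₁ (fresh-chain⇒ E t ch)
      span⊆E : ∀ x → span t ∋ x → E ∋ x
      span⊆E x x∈ with span-elim t x∈
      ... | c , refl = lc-closed sE c t (proj₂ (fresh-chain⇒ E t ch))

  size-direct-sum : ∀ {n} (X Y : SubsetV n) → IsSubspace X → IsSubspace Y → TrivialIntersection X Y →
                    ∣ X ⊕ Y ∣ ≡ ∣ X ∣ * ∣ Y ∣
  size-direct-sum X Y sX sY triv = sym (begin
      ∣ X ∣ * ∣ Y ∣              ≡⟨ product-formula X Y sX sY ⟩
      ∣ X ⊕ Y ∣ * ∣ X ∩ Y ∣      ≡⟨ cong (∣ X ⊕ Y ∣ *_) ∣X∩Y∣≡1 ⟩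
      ∣ X ⊕ Y ∣ * 1              ≡⟨ *-identityʳ _ ⟩
      ∣ X ⊕ Y ∣                  ∎)
    where
    open ≡-Reasoning
    ∣X∩Y∣≡1 : ∣ X ∩ Y ∣ ≡ 1
    ∣X∩Y∣≡1 = size-zero (X ∩ Y) (∩-intro X Y (zero-mem sX) (zero-mem sY))
                (λ x x∈ → triv x (∩-elimˡ X Y x∈) (∩-elimʳ X Y x∈))

  inclusion-exclusion : ∀ {n} (X Y : SubsetV n) →
    ∑ (elemsV n) (λ v → ⟦ not (X v) ∧ not (Y v) ⟧) + ∣ X ∣ + ∣ Y ∣ ≡ q ^ n + ∣ X ∩ Y ∣
  inclusion-exclusion {n} X Y = begin
      ∑ (elemsV n) (λ v → ⟦ not (X v) ∧ not (Y v) ⟧) + ∣ X ∣ + ∣ Y ∣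
    ≡⟨ cong (_+ ∣ Y ∣) (sym (∑-+ (elemsV n) _ _)) ⟩
      ∑ (elemsV n) (λ v → ⟦ not (X v) ∧ not (Y v) ⟧ + ⟦ X v ⟧) + ∣ Y ∣
    ≡⟨ sym (∑-+ (elemsV n) _ _) ⟩
      ∑ (elemsV n) (λ v → ⟦ not (X v) ∧ not (Y v) ⟧ + ⟦ X v ⟧ + ⟦ Y v ⟧)
    ≡⟨ ∑-cong (elemsV n) (λ v → trans (⟦not∧not⟧ (X v) (Y v)) (cong (λ b → 1 + ⟦ b ⟧) (sym (∩-char X Y v)))) ⟩
      ∑ (elemsV n) (λ v → 1 + ⟦ (X ∩ Y) v ⟧)
    ≡⟨ ∑-+ (elemsV n) (λ _ → 1) _ ⟩
      card (Venum n) + ∣ X ∩ Y ∣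
    ≡⟨ cong (_+ ∣ X ∩ Y ∣) (card-V n) ⟩
      q ^ n + ∣ X ∩ Y ∣
    ∎
    where open ≡-Reasoning

  same-span : ∀ {n j} (t t₀ : Vec (V n) j) → Independent t → Independent t₀ → All (span t₀ ∋_) t → span t ≐ span t₀
  same-span t t₀ ind ind₀ t⊆ x = ∋-cong (span t) (span t₀) (span-t⊆span-t₀ x)
    (size-⊆-tight (span t) (span t₀) span-t⊆span-t₀ (≤-reflexive (trans (size-span t₀ ind₀) (sym (size-span t ind)))) x)
    where
    span-t⊆span-t₀ : ∀ y → span t ∋ y → span t₀ ∋ y
    span-t⊆span-t₀ y y∈ with span-elim t y∈
    ... | c , refl = lc-closed (span-subspace t₀) c t t⊆

prod-cong< : ∀ d (f g : ℕ → ℕ) → (∀ i → i < d → f i ≡ g i) → prod d f ≡ prod d g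
prod-cong< zero    f g e = refl
prod-cong< (suc d) f g e = cong₂ _*_ (prod-cong< d f g (λ i i<d → e i (m<n⇒m<1+n i<d))) (e d (n<1+n d))

prod-* : ∀ d (f g : ℕ → ℕ) → prod d (λ i → f i * g i) ≡ prod d f * prod d g
prod-* zero    f g = refl
prod-* (suc d) f g = trans (cong (_* (f d * g d)) (prod-* d f g)) (regroup (prod d f) (prod d g) (f d) (g d))
  where
  regroup : ∀ A B x y → A * B * (x * y) ≡ A * x * (B * y)
  regroup = solve-∀

prod-nonZero : ∀ d (f : ℕ → ℕ) → (∀ i → NonZero (f i)) → NonZero (prod d f)
prod-nonZero zero    f nz = _
prod-nonZero (suc d) f nz = m*n≢0 (prod d f) (f d) {{prod-nonZero d f nz}} {{nz d}}

-- Solving the two counting equations of one extension step (see the main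
-- count): with  |W + A| = P(1+x),  |W + B| = P(1+y),  |F^n| = P(1+x)(1+y),
-- the product formula forces |(W + A) ∩ (W + B)| = P, and inclusion–exclusion
-- then leaves  P x y  vectors outside both sums.
solve-counts : ∀ S P x y m .{{_ : NonZero P}} →
               S + P * (1 + x) + P * (1 + y) ≡ P * (1 + x) * (1 + y) + m →
               P * (1 + x) * (P * (1 + y)) ≡ P * (1 + x) * (1 + y) * m →
               S ≡ P * x * y
solve-counts S P x y m incl-excl product = +-cancelʳ-≡ (P + P * x + P + P * y) S (P * x * y) (begin
    S + (P + P * x + P + P * y)               ≡⟨ expand₁ S P x y ⟩
    S + P * (1 + x) + P * (1 + y)             ≡⟨ incl-excl ⟩
    P * (1 + x) * (1 + y) + m                 ≡⟨ cong (P * (1 + x) * (1 + y) +_) m≡P ⟩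
    P * (1 + x) * (1 + y) + P                 ≡⟨ expand₂ P x y ⟩
    P * x * y + (P + P * x + P + P * y)       ∎)
  where
  open ≡-Reasoning
  expand₁ : ∀ S P x y → S + (P + P * x + P + P * y) ≡ S + P * (1 + x) + P * (1 + y)
  expand₁ = solve-∀
  expand₂ : ∀ P x y → P * (1 + x) * (1 + y) + P ≡ P * x * y + (P + P * x + P + P * y)
  expand₂ = solve-∀
  swap : ∀ P x y → P * (1 + x) * (P * (1 + y)) ≡ P * (1 + x) * (1 + y) * P
  swap = solve-∀
  instance
    nz : NonZero (P * (1 + x) * (1 + y))
    nz = m*n≢0 (P * (1 + x)) (1 + y) {{m*n≢0 P (1 + x)}}
  m≡P : m ≡ P
  m≡P = *-cancelˡ-≡ m P (P * (1 + x) * (1 + y)) (trans (sym product) (swap P x y))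

-- One extension step of the main count, for a chain of length j: with
-- α = a - c - j,  β = b - c - j  and  P = q^j q^(j+c)  the sizes  q^j q^a,
-- q^j q^b  and  q^(a+b-c)  are  P q^α,  P q^β  and  P q^α q^β, so
-- solve-counts applies.
module ExtensionStep (q j a b c : ℕ) .{{_ : NonZero q}} (c≤a : c ≤ a) (c≤b : c ≤ b) (j≤α : j ≤ a ∸ c) (j≤β : j ≤ b ∸ c) where

  private
    α β P : ℕ
    α = a ∸ c ∸ j
    β = b ∸ c ∸ j
    P = q ^ j * q ^ (j + c)

    split : ∀ e → c ≤ e → j ≤ e ∸ c → e ≡ (j + c) + (e ∸ c ∸ j)
    split e c≤e j≤ = begin
        e                          ≡⟨ sym (m∸n+n≡m c≤e) ⟩
        e ∸ c + c                  ≡⟨ cong (_+ c) (sym (m∸n+n≡m j≤)) ⟩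
        e ∸ c ∸ j + j + c          ≡⟨ reorder (e ∸ c ∸ j) j c ⟩
        (j + c) + (e ∸ c ∸ j)      ∎
      where
      open ≡-Reasoning
      reorder : ∀ γ j c → γ + j + c ≡ j + c + γ
      reorder = solve-∀

    scaled : ∀ e → c ≤ e → j ≤ e ∸ c → q ^ j * q ^ e ≡ P * q ^ (e ∸ c ∸ j)
    scaled e c≤e j≤ = begin
        q ^ j * q ^ e                               ≡⟨ cong (λ k → q ^ j * q ^ k) (split e c≤e j≤) ⟩
        q ^ j * q ^ ((j + c) + (e ∸ c ∸ j))         ≡⟨ cong (q ^ j *_) (^-distribˡ-+-* q (j + c) _) ⟩
        q ^ j * (q ^ (j + c) * q ^ (e ∸ c ∸ j))     ≡⟨ sym (*-assoc (q ^ j) _ _) ⟩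
        P * q ^ (e ∸ c ∸ j)                         ∎
      where open ≡-Reasoning

    size-A : q ^ j * q ^ a ≡ P * q ^ α
    size-A = scaled a c≤a j≤α

    size-B : q ^ j * q ^ b ≡ P * q ^ β
    size-B = scaled b c≤b j≤β

    size-whole : q ^ (a + b ∸ c) ≡ P * q ^ α * q ^ β
    size-whole = begin
        q ^ (a + b ∸ c)                          ≡⟨ cong (q ^_) (+-∸-assoc a c≤b) ⟩
        q ^ (a + (b ∸ c))                        ≡⟨ ^-distribˡ-+-* q a (b ∸ c) ⟩
        q ^ a * q ^ (b ∸ c)                      ≡⟨ cong (q ^ a *_) (cong (q ^_) (sym (m∸n+n≡m j≤β))) ⟩
        q ^ a * q ^ (β + j)                      ≡⟨ cong (q ^ a *_) (^-distribˡ-+-* q β j) ⟩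
        q ^ a * (q ^ β * q ^ j)                  ≡⟨ regroup (q ^ a) (q ^ β) (q ^ j) ⟩
        q ^ j * q ^ a * q ^ β                    ≡⟨ cong (_* q ^ β) size-A ⟩
        P * q ^ α * q ^ β                        ∎
      where
      open ≡-Reasoning
      regroup : ∀ A B J → A * (B * J) ≡ J * A * B
      regroup = solve-∀

  -- S vectors outside (W + A) ∪ (W + B), with m = |(W + A) ∩ (W + B)|
  extension-count : ∀ S m →
    S + q ^ j * q ^ a + q ^ j * q ^ b ≡ q ^ (a + b ∸ c) + m →
    (q ^ j * q ^ a) * (q ^ j * q ^ b) ≡ q ^ (a + b ∸ c) * m →
    S ≡ q ^ j * (q ^ (j + c) * (q ^ α ∸ 1) * (q ^ β ∸ 1))
  extension-count S m incl-excl product =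
    trans (solve-counts S P x y m {{nz}} incl-excl' product') (regroup (q ^ j) (q ^ (j + c)) x y)
    where
    x = q ^ α ∸ 1
    y = q ^ β ∸ 1
    nz : NonZero P
    nz = m*n≢0 (q ^ j) (q ^ (j + c)) {{m^n≢0 q j}} {{m^n≢0 q (j + c)}}
    pred-pow : ∀ e → q ^ e ≡ 1 + (q ^ e ∸ 1)
    pred-pow e = sym (m+[n∸m]≡n (m^n>0 q e))
    A≡ : q ^ j * q ^ a ≡ P * (1 + x)
    A≡ = trans size-A (cong (P *_) (pred-pow α))
    B≡ : q ^ j * q ^ b ≡ P * (1 + y)
    B≡ = trans size-B (cong (P *_) (pred-pow β))
    whole≡ : q ^ (a + b ∸ c) ≡ P * (1 + x) * (1 + y)
    whole≡ = trans size-whole (cong₂ (λ u v → P * u * v) (pred-pow α) (pred-pow β))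
    incl-excl' : S + P * (1 + x) + P * (1 + y) ≡ P * (1 + x) * (1 + y) + m
    incl-excl' = trans (cong₂ (λ u v → S + u + v) (sym A≡) (sym B≡)) (trans incl-excl (cong (_+ m) whole≡))
    product' : P * (1 + x) * (P * (1 + y)) ≡ P * (1 + x) * (1 + y) * m
    product' = trans (cong₂ _*_ (sym A≡) (sym B≡)) (trans product (cong (_* m) whole≡))
    regroup : ∀ Qj Qjc x y → Qj * Qjc * x * y ≡ Qj * (Qjc * x * y)
    regroup = solve-∀

divide-bases : ∀ q a b c d N .{{_ : NonZero q}} →
  N * prod d (λ i → q ^ d ∸ q ^ i) ≡ prod d (λ i → q ^ i * (q ^ (i + c) * (q ^ (a ∸ c ∸ i) ∸ 1) * (q ^ (b ∸ c ∸ i) ∸ 1))) →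
  N * ψ-den q d ≡ ψ-num q a b c d
divide-bases q a b c d N counted = *-cancelˡ-≡ (N * ψ-den q d) (ψ-num q a b c d) Q {{nz}} (begin
    Q * (N * ψ-den q d)                       ≡⟨ swap Q N (ψ-den q d) ⟩
    N * (Q * ψ-den q d)                       ≡⟨ cong (N *_) (sym bases) ⟩
    N * prod d (λ i → q ^ d ∸ q ^ i)          ≡⟨ counted ⟩
    prod d (λ i → q ^ i * _)                  ≡⟨ prod-* d (q ^_) _ ⟩
    Q * ψ-num q a b c d                       ∎)
  where
  open ≡-Reasoning
  Q = prod d (q ^_)
  nz : NonZero Q
  nz = prod-nonZero d (q ^_) (λ i → m^n≢0 q i)
  swap : ∀ Q N D → Q * (N * D) ≡ N * (Q * D)
  swap = solve-∀
  factor : ∀ i → i ≤ d → q ^ d ∸ q ^ i ≡ q ^ i * (q ^ (d ∸ i) ∸ 1)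
  factor i i≤d = sym (trans (*-distribˡ-∸ (q ^ i) (q ^ (d ∸ i)) 1)
    (cong₂ _∸_ (trans (sym (^-distribˡ-+-* q i (d ∸ i))) (cong (q ^_) (m+[n∸m]≡n i≤d))) (*-identityʳ (q ^ i))))
  bases : prod d (λ i → q ^ d ∸ q ^ i) ≡ Q * ψ-den q d
  bases = trans (prod-cong< d _ _ (λ i i<d → factor i (<⇒≤ i<d))) (prod-* d (q ^_) _)

prime-power≥2 : ∀ {q} → IsPrimePower q → 2 ≤ q
prime-power≥2 (p , suc k , prime {{nt}} _ , _ , refl) = ≤-trans (nonTrivial⇒n>1 p {{nt}}) p≤p^suc-k
  where
  p≤p^suc-k : p ≤ p * p ^ k
  p≤p^suc-k = m≤m*n p (p ^ k) {{m^n≢0 p k {{nonTrivial⇒nonZero p {{nt}}}}}}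

module Bases {q : ℕ} (F : FiniteField q) where

  open FiniteField F using (Carrier; 0#)
  open LinearAlgebra F
  open VectorSpace F

  lincomb≡lc : ∀ {n} d (c : Fin d → Carrier) (v : Fin d → V n) → lincomb d c v ≡ lc (tabulate c) (tabulate v)
  lincomb≡lc zero    c v = refl
  lincomb≡lc (suc d) c v = cong (c fzero ⊡ v fzero ⊞_) (lincomb≡lc d (λ i → c (fsuc i)) (λ i → v (fsuc i)))

  VecBasis : ∀ {n} k → SubsetV n → Set
  VecBasis {n} k S = Σ (Vec (V n) k) λ t → All (S ∋_) t × Independent t × (∀ x → S ∋ x → ∃ λ c → lc c t ≡ x)

  vec-basis : ∀ {n k} {S : SubsetV n} → SubspaceOfDim k S → VecBasis k S
  vec-basis {k = k} (_ , v , v⊆S , indep , spans) = tabulate v , tabulate⁺ v⊆S , ind , spans'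
    where
    ind : Independent (tabulate v)
    ind c e = begin
        c                         ≡⟨ sym (Vecₚ.tabulate∘lookup c) ⟩
        tabulate (lookup c)       ≡⟨ Vecₚ.tabulate-cong (λ i → trans (indep (lookup c) e' i) (sym (Vecₚ.lookup-replicate i 0#))) ⟩
        tabulate (lookup 0v)      ≡⟨ Vecₚ.tabulate∘lookup 0v ⟩
        0v                        ∎
      where
      open ≡-Reasoning
      e' : lincomb k (lookup c) v ≡ 0v
      e' = trans (lincomb≡lc k (lookup c) v) (trans (cong (λ w → lc w (tabulate v)) (Vecₚ.tabulate∘lookup c)) e)
    spans' : ∀ x → _ → ∃ λ c → lc c (tabulate v) ≡ x
    spans' x x∈ with spans x x∈
    ... | c , e = tabulate c , sym (trans e (lincomb≡lc k c v))

  span-dim : ∀ {n j} (t : Vec (V n) j) → Independent t → SubspaceOfDim j (span t)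
  span-dim {j = j} t ind = span-subspace t , lookup t , lookup⁺ (span-entries t) , indep , spans
    where
    lincomb≡lc' : ∀ c → lincomb j c (lookup t) ≡ lc (tabulate c) t
    lincomb≡lc' c = trans (lincomb≡lc j c (lookup t)) (cong (lc (tabulate c)) (Vecₚ.tabulate∘lookup t))
    indep : LinearlyIndependent j (lookup t)
    indep c e i = begin
        c i                        ≡⟨ sym (Vecₚ.lookup∘tabulate c i) ⟩
        lookup (tabulate c) i      ≡⟨ cong (λ w → lookup w i) (ind (tabulate c) (trans (sym (lincomb≡lc' c)) e)) ⟩
        lookup 0v i                ≡⟨ Vecₚ.lookup-replicate i 0# ⟩
        0#                         ∎
      where open ≡-Reasoning
    spans : ∀ x → span t ∋ x → ∃ λ c → x ≡ lincomb j c (lookup t)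
    spans x x∈ with span-elim t x∈
    ... | c , e = lookup c , sym (trans (lincomb≡lc' (lookup c)) (trans (cong (λ w → lc w t) (Vecₚ.tabulate∘lookup c)) e))

module MainCount {q : ℕ} (F : FiniteField q) (q≥2 : 2 ≤ q) (a b c d : ℕ) (A B : LinearAlgebra.SubsetV F (a + b ∸ c))
  (dimA : LinearAlgebra.SubspaceOfDim F a A) (dimB : LinearAlgebra.SubspaceOfDim F b B)
  (dimA∩B : LinearAlgebra.SubspaceOfDim F c (LinearAlgebra._∩_ F A B)) where

  open LinearAlgebra F
  open VectorSpace F
  open Counting F
  open Bases F
  open IsSubspace

  n : ℕ
  n = a + b ∸ c

  instance
    q≢0 : NonZero q
    q≢0 = >-nonZero (≤-trans (s≤s z≤n) q≥2)

  ^-cancel-≤ : ∀ {x y} → q ^ x ≤ q ^ y → x ≤ y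
  ^-cancel-≤ le = ≮⇒≥ (λ y<x → <⇒≱ (^-monoʳ-< q q≥2 y<x) le)

  size-dim : ∀ {k} {S : SubsetV n} → SubspaceOfDim k S → ∣ S ∣ ≡ q ^ k
  size-dim dimS with vec-basis dimS
  ... | t , t⊆S , ind , spans = size-basis (proj₁ dimS) t t⊆S ind spans

  sA = proj₁ dimA
  sB = proj₁ dimB

  c≤a : c ≤ a
  c≤a = ^-cancel-≤ (subst₂ _≤_ (size-dim dimA∩B) (size-dim dimA) (size-mono (A ∩ B) A (λ _ → ∩-elimˡ A B)))

  c≤b : c ≤ b
  c≤b = ^-cancel-≤ (subst₂ _≤_ (size-dim dimA∩B) (size-dim dimB) (size-mono (A ∩ B) B (λ _ → ∩-elimʳ A B)))

  A⊕B-everything : ∀ z → (A ⊕ B) ∋ z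
  A⊕B-everything = size-full (A ⊕ B) (≤-reflexive (sym (*-cancelʳ-≡ ∣ A ⊕ B ∣ (q ^ n) (q ^ c) {{m^n≢0 q c}} (begin
      ∣ A ⊕ B ∣ * q ^ c          ≡⟨ cong (∣ A ⊕ B ∣ *_) (sym (size-dim dimA∩B)) ⟩
      ∣ A ⊕ B ∣ * ∣ A ∩ B ∣      ≡⟨ sym (product-formula A B sA sB) ⟩
      ∣ A ∣ * ∣ B ∣              ≡⟨ cong₂ _*_ (size-dim dimA) (size-dim dimB) ⟩
      q ^ a * q ^ b              ≡⟨ sym (^-distribˡ-+-* q a b) ⟩
      q ^ (a + b)                ≡⟨ cong (q ^_) (sym (m∸n+n≡m (≤-trans c≤a (m≤m+n a b)))) ⟩
      q ^ (n + c)                ≡⟨ ^-distribˡ-+-* q n c ⟩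
      q ^ n * q ^ c              ∎))))
    where open ≡-Reasoning

  ψ-factor : ℕ → ℕ
  ψ-factor j = q ^ (j + c) * (q ^ (a ∸ c ∸ j) ∸ 1) * (q ^ (b ∸ c ∸ j) ∸ 1)

  -- An avoiding chain t of length j spans W with W ∩ A = W ∩ B = {0}; the
  -- admissible next vectors are those outside (W + A) ∪ (W + B), where
  -- |W + A| = q^(j+a), |W + B| = q^(j+b) and (W + A) + (W + B) = F^n.
  avoiding-extensions : ∀ j (t : Vec (V n) j) → Chain (Avoiding A B) (avoiding? A B) t ≡ true →
                        ∑ (elemsV n) (λ v → ⌊ avoiding? A B t v ⌋) ≡ q ^ j * ψ-factor j
  avoiding-extensions j t ch with avoiding-chain⇒ sA sB t ch
  ... | ind , trivA , trivB = ExtensionStep.extension-count q j a b c c≤a c≤b j≤a-c j≤b-c outside ∣ X ∩ Y ∣ incl-excl product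
    where
    W = span t
    sW = span-subspace t
    X = W ⊕ A
    Y = W ⊕ B
    sX = ⊕-subspace W A sW sA
    sY = ⊕-subspace W B sW sB
    outside = ∑ (elemsV n) (λ v → ⌊ avoiding? A B t v ⌋)
    ∣X∣ : ∣ X ∣ ≡ q ^ j * q ^ a
    ∣X∣ = trans (size-direct-sum W A sW sA trivA) (cong₂ _*_ (size-span t ind) (size-dim dimA))
    ∣Y∣ : ∣ Y ∣ ≡ q ^ j * q ^ b
    ∣Y∣ = trans (size-direct-sum W B sW sB trivB) (cong₂ _*_ (size-span t ind) (size-dim dimB))
    X⊕Y-everything : ∀ z → (X ⊕ Y) ∋ z
    X⊕Y-everything z with ⊕-elim A B (A⊕B-everything z)
    ... | x , y , x∈A , y∈B , refl = ⊕-intro X Y (⊕-inclʳ W A sW x∈A) (⊕-inclʳ W B sW y∈B)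
    incl-excl : outside + q ^ j * q ^ a + q ^ j * q ^ b ≡ q ^ n + ∣ X ∩ Y ∣
    incl-excl = trans (cong₂ (λ u v → outside + u + v) (sym ∣X∣) (sym ∣Y∣)) (inclusion-exclusion X Y)
    product : (q ^ j * q ^ a) * (q ^ j * q ^ b) ≡ q ^ n * ∣ X ∩ Y ∣
    product = begin
      (q ^ j * q ^ a) * (q ^ j * q ^ b)  ≡⟨ cong₂ _*_ (sym ∣X∣) (sym ∣Y∣) ⟩
      ∣ X ∣ * ∣ Y ∣                      ≡⟨ product-formula X Y sX sY ⟩
      ∣ X ⊕ Y ∣ * ∣ X ∩ Y ∣              ≡⟨ cong (_* ∣ X ∩ Y ∣) (size-all (X ⊕ Y) X⊕Y-everything) ⟩
      q ^ n * ∣ X ∩ Y ∣                  ∎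
      where open ≡-Reasoning
    -- |W + A| ≤ q^n gives j + a ≤ n, i.e. j ≤ b - c; symmetrically j ≤ a - c
    j+a≤n : j + a ≤ n
    j+a≤n = ^-cancel-≤ (subst (_≤ q ^ n) (trans ∣X∣ (sym (^-distribˡ-+-* q j a))) (size-≤ X))
    j+b≤n : j + b ≤ n
    j+b≤n = ^-cancel-≤ (subst (_≤ q ^ n) (trans ∣Y∣ (sym (^-distribˡ-+-* q j b))) (size-≤ Y))
    j≤b-c : j ≤ b ∸ c
    j≤b-c = +-cancelˡ-≤ a j (b ∸ c) (subst₂ _≤_ (+-comm j a) (+-∸-assoc a c≤b) j+a≤n)
    j≤a-c : j ≤ a ∸ c
    j≤a-c = +-cancelʳ-≤ b j (a ∸ c) (subst (j + b ≤_) (+-∸-comm b c≤a) j+b≤n)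

  #avoiding-chains : ∀ j → #chains (Avoiding A B) (avoiding? A B) j ≡ prod j (λ i → q ^ i * ψ-factor i)
  #avoiding-chains zero    = refl
  #avoiding-chains (suc j) = trans (#chains-suc (Avoiding A B) (avoiding? A B) j _ (avoiding-extensions j))
                                   (cong (_* (q ^ j * ψ-factor j)) (#avoiding-chains j))

  Solution : SubsetV n → Set
  Solution D = SubspaceOfDim d D × TrivialIntersection D A × TrivialIntersection D B

  avoidingChain : Vec (V n) d → Bool
  avoidingChain = Chain (Avoiding A B) (avoiding? A B)

  IsAvoidingChain : Vec (V n) d → Set
  IsAvoidingChain t = avoidingChain t ≡ true

  avoidingChain? : ∀ t → Dec (IsAvoidingChain t)
  avoidingChain? t = avoidingChain t Bool.≟ true

  solutions : List (SubsetV n)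
  solutions = deduplicate _≐?_ (map span (filter avoidingChain? (elemsT n d)))

  solutions⁻ : ∀ {E} → E ∈ solutions → ∃ λ t → IsAvoidingChain t × E ≡ span t
  solutions⁻ E∈ with ∈-map∘filter⁻ span avoidingChain? {xs = elemsT n d} (∈-deduplicate⁻ _≐?_ _ E∈)
  ... | t , _ , E≡ , ch = t , ch , E≡

  solutions⁺ : ∀ t → IsAvoidingChain t → Any (span t ≐_) solutions
  solutions⁺ t ch = Anyₚ.deduplicate⁺ _≐?_ (λ E'≐E t≐E x → trans (t≐E x) (sym (E'≐E x)))
    (anyMap (λ { refl _ → refl }) (∈-map∘filter⁺ span avoidingChain? (t , complete (vecEnum (Venum n) d) t , refl , ch)))

  solutions-count : CountIs Solution (length solutions)
  solutions-count = solutions , sound , cover , deduplicate-! (subsetDecSetoid n) _ , refl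
    where
    sound : ∀ {E} → E ∈ solutions → Solution E
    sound E∈ with solutions⁻ E∈
    ... | t , ch , refl with avoiding-chain⇒ sA sB t ch
    ...   | ind , trivA , trivB = span-dim t ind , trivA , trivB
    cover : ∀ D → Solution D → Any (D ≐_) solutions
    cover D (dimD , trivA , trivB) with vec-basis dimD
    ... | t , t⊆D , ind , spans = anyMap (λ t≐E x → trans (D≐t x) (t≐E x)) (solutions⁺ t ch)
      where
      D⊆span : ∀ x → D ∋ x → span t ∋ x
      D⊆span x x∈ with spans x x∈
      ... | c , refl = span-intro c t
      span⊆D : ∀ x → span t ∋ x → D ∋ x
      span⊆D x x∈ with span-elim t x∈
      ... | c , refl = lc-closed (proj₁ dimD) c t t⊆D
      D≐t : D ≐ span t
      D≐t x = ∋-cong D (span t) (D⊆span x) (span⊆D x)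
      ch = avoiding-chain⇐ t ind (λ x x∈ → trivA x (span⊆D x x∈)) (λ x x∈ → trivB x (span⊆D x x∈))

  #ordered-bases : ℕ
  #ordered-bases = prod d (λ i → q ^ d ∸ q ^ i)

  -- each E = span t₀ in the list is the span of exactly #ordered-bases avoiding
  -- chains: an avoiding chain spans E iff it is an ordered basis of E
  chains-spanning : ∀ {E} → E ∈ solutions →
    ∑ (elemsT n d) (λ t → ⟦ avoidingChain t ⟧ * ⌊ span t ≐? E ⌋) ≡ #ordered-bases
  chains-spanning E∈ with solutions⁻ E∈
  ... | t₀ , ch₀ , refl with avoiding-chain⇒ sA sB t₀ ch₀
  ...   | ind₀ , trivA₀ , trivB₀ =
    trans (∑-cong (elemsT n d) spans-E⇔basis) (#independent-lists E d (span-subspace t₀) (size-span t₀ ind₀) d)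
    where
    E = span t₀
    basis : Vec (V n) d → Bool
    basis = Chain (FreshIn E) (freshIn? E)
    spans-E⇔basis : ∀ t → ⟦ avoidingChain t ⟧ * ⌊ span t ≐? E ⌋ ≡ ⟦ basis t ⟧
    spans-E⇔basis t = trans (sym (⟦∧⟧ (avoidingChain t) (does (span t ≐? E)))) (cong ⟦_⟧ (true-iff spanning⇒basis basis⇒spanning))
      where
      spanning⇒basis : (avoidingChain t ∧ does (span t ≐? E)) ≡ true → basis t ≡ true
      spanning⇒basis h = fresh-chain⇐ E t (proj₁ (avoiding-chain⇒ sA sB t (∧-conicalˡ _ _ h)))
        (allMap (λ {x} x∈ → trans (sym (t≐E x)) x∈) (span-entries t))
        where t≐E = does-sound (span t ≐? E) (∧-conicalʳ _ _ h)
      basis⇒spanning : basis t ≡ true → (avoidingChain t ∧ does (span t ≐? E)) ≡ true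
      basis⇒spanning h with fresh-chain⇒ E t h
      ... | ind , t⊆E = cong₂ _∧_
        (avoiding-chain⇐ t ind (λ x x∈ → trivA₀ x (trans (sym (t≐E x)) x∈)) (λ x x∈ → trivB₀ x (trans (sym (t≐E x)) x∈)))
        (dec-true (span t ≐? E) t≐E)
        where t≐E = same-span t t₀ ind ind₀ t⊆E

  #avoiding-chains-by-span : #chains (Avoiding A B) (avoiding? A B) d ≡ length solutions * #ordered-bases
  #avoiding-chains-by-span = begin
      ∑ (elemsT n d) (λ t → ⟦ avoidingChain t ⟧)
    ≡⟨ ∑-cong (elemsT n d) spans-one-solution ⟩
      ∑ (elemsT n d) (λ t → ∑ solutions (λ E → ⟦ avoidingChain t ⟧ * ⌊ span t ≐? E ⌋))
    ≡⟨ ∑-swap (elemsT n d) solutions _ ⟩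
      ∑ solutions (λ E → ∑ (elemsT n d) (λ t → ⟦ avoidingChain t ⟧ * ⌊ span t ≐? E ⌋))
    ≡⟨ ∑-cong-∈ solutions chains-spanning ⟩
      ∑ solutions (λ _ → #ordered-bases)
    ≡⟨ ∑-const solutions #ordered-bases ⟩
      length solutions * #ordered-bases
    ∎
    where
    open ≡-Reasoning
    spans-one-solution : ∀ t → ⟦ avoidingChain t ⟧ ≡ ∑ solutions (λ E → ⟦ avoidingChain t ⟧ * ⌊ span t ≐? E ⌋)
    spans-one-solution t with true? (avoidingChain t)
    ... | inj₁ ch = sym (begin
        ∑ solutions (λ E → ⟦ avoidingChain t ⟧ * ⌊ span t ≐? E ⌋)  ≡⟨ ∑-*ˡ solutions ⟦ avoidingChain t ⟧ _ ⟩
        ⟦ avoidingChain t ⟧ * ∑ solutions (λ E → ⌊ span t ≐? E ⌋)  ≡⟨ cong (⟦ avoidingChain t ⟧ *_) once ⟩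
        ⟦ avoidingChain t ⟧ * 1                                     ≡⟨ *-identityʳ _ ⟩
        ⟦ avoidingChain t ⟧                                         ∎)
      where
      once : ∑ solutions (λ E → ⌊ span t ≐? E ⌋) ≡ 1
      once = ∑-unique (subsetDecSetoid n) solutions (deduplicate-! (subsetDecSetoid n) _) (solutions⁺ t ch)
    ... | inj₂ ¬ch rewrite ⟦⟧-false ¬ch = sym (∑-zero solutions (λ _ → refl))

lemma1 : (q : ℕ) → IsPrimePower q → (F : FiniteField q) →
         let open LinearAlgebra F in
         (a b c d : ℕ) (A B : SubsetV (a + b ∸ c)) →
         SubspaceOfDim a A → SubspaceOfDim b B → SubspaceOfDim c (A ∩ B) →
         Σ ℕ λ N →
           CountIs (λ D → SubspaceOfDim d D × TrivialIntersection D A × TrivialIntersection D B) N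
           × N * ψ-den q d ≡ ψ-num q a b c d
lemma1 q q-prime-power F a b c d A B dimA dimB dimA∩B =
  length solutions , solutions-count , divide-bases q a b c d (length solutions) (begin
    length solutions * #ordered-bases          ≡⟨ sym #avoiding-chains-by-span ⟩
    #chains (Avoiding A B) (avoiding? A B) d   ≡⟨ #avoiding-chains d ⟩
    prod d (λ i → q ^ i * ψ-factor i)          ∎)
  where
  open MainCount F (prime-power≥2 q-prime-power) a b c d A B dimA dimB dimA∩B
  open VectorSpace F using (Avoiding; avoiding?)
  open Counting F using (#chains)
  open ≡-Reasoning
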